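{- Every core formulae (an expression of one of the forms $t_1=t_2$, $\mathrm{sees}_{\mathcal{T}}(t_1,t_2)\geq\beta+1$, or $\mathrm{rem}_{\mathcal{P}}\geq\beta$, for terms $t_1,t_2$, a finite set of terms $\mathcal{T}$, a finite set of pairs of terms $\mathcal{P}$ and $\beta\in\mathbb{N}$) is logically equivalent to a formula of $\mathrm{SL}(*,\exists{:}{\rightsquigarrow})$, i.e. there is a formula of that logic satisfied by exactly the same memory states.
   Context: Let $\mathrm{PVAR}$ be a countably infinite set of program variables and $\mathrm{LOC}$ a countably infinite set of locations. A memory state is a pair $(s,h)$ with $s:\mathrm{PVAR}\to\mathrm{LOC}$ and $h:\mathrm{LOC}\to\mathrm{LOC}$ a partial function with finite domain. Disjoint heaps (disjoint domains) $h_1,h_2$ have union $h_1+h_2$. Let $h^0$ be the identity on $\mathrm{LOC}$ and $h^n(\ell)=h(h^{n-1}(\ell))$ when $h^{n-1}(\ell)$ is defined and in $\mathrm{dom}(h)$, undefined otherwise. $\mathrm{minpath}_h(\ell_1,\ell_2)$ is the set of $\ell$ such that there are $\delta_1\geq0$, $\delta_2\geq1$ with $h^{\delta_1}(\ell_1)=\ell$, $h^{\delta_2}(\ell)=\ell_2$ and $h^\delta(\ell_1)\neq\ell_2$ for all $\delta\in[1,\delta_1+\delta_2-1]$. Formulae of $\mathrm{SL}(*,\exists{:}{\rightsquigarrow})$: $\varphi ::= x=y\mid x\hookrightarrow y\mid\mathrm{emp}\mid\neg\varphi\mid\varphi\wedge\varphi\mid\varphi*\varphi\mid\exists z{:}x\rightsquigarrow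 y\ \varphi$, with $x=y$: $s(x)=s(y)$; $x\hookrightarrow y$: $s(x)\in\mathrm{dom}(h)$ and $h(s(x))=s(y)$; $\mathrm{emp}$: $\mathrm{dom}(h)=\emptyset$; Boolean connectives as usual; $\varphi_1*\varphi_2$: $h=h_1+h_2$ for disjoint $h_1,h_2$ with $(s,h_i)\models\varphi_i$; $\exists z{:}x\rightsquigarrow y\ \varphi$: $\mathrm{minpath}_h(s(x),s(y))\neq\emptyset$ and some $\ell\in\mathrm{minpath}_h(s(x),s(y))\cup\{s(y)\}$ has $(s[z\leftarrow\ell],h)\models\varphi$. Terms: program variables $x$ and meet-point terms $m(x,y,z)$ with $x,y,z\in\mathrm{PVAR}$. Interpretation: $[\![x]\!]_{s,h}=s(x)$; $[\![m(x,y,z)]\!]_{s,h}$ is defined and equals $\ell$ iff there are $\delta_1,\delta_2\geq0$ with $h^{\delta_1}(s(x))=h^{\delta_2}(s(y))=\ell$, some $\delta\geq0$ with $h^\delta(\ell)=s(z)$, and for every $\delta_1'\in[0,\delta_1-1]$ and $\delta_2'\geq0$, $h^{\delta_1'}(s(x))\neq h^{\delta_2'}(s(y))$. Semantics of core formulae: $(s,h)\models t_1=t_2$ iff $[\![t_1]\!]_{s,h}=[\![t_2]\!]_{s,h}$ (both defined); $(s,h)\models\mathrm{sees}_{\mathcal{T}}(t_1,t_2)\geq\beta$ iff there is $\delta\geq\beta$ with $h^\delta([\![t_1]\!]_{s,h})=[\![t_2]\!]_{s,h}$ and for all $\delta'\in[1,\delta-1]$, $h^{\delta'}([\![t_1]\!]_{s,h})\notin\{[\![t_2]\!]_{s,h}\}\cup\{[\![t]\!]_{s,h}\mid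 t\in\mathcal{T}\}$; $(s,h)\models\mathrm{rem}_{\mathcal{P}}\geq\beta$ iff the set $\mathrm{dom}(h)\setminus\bigcup_{(t_1,t_2)\in\mathcal{P}}\mathrm{minpath}_h([\![t_1]\!]_{s,h},[\![t_2]\!]_{s,h})$ has at least $\beta$ elements. -}

module Defs where

open import Data.Nat using (ℕ; zero; suc; _+_; _∸_; _≤_; _<_; _≟_)
open import Data.Maybe using (Maybe; just; nothing; _>>=_)
open import Data.Product using (Σ; ∃; _×_; _,_)
open import Data.Sum using (_⊎_)
open import Data.Empty using (⊥)
open import Data.List using (List)
open import Data.List.Membership.Propositional using (_∈_)
open import Data.Vec using (Vec; lookup)
open import Data.Fin using (Fin)
open import Function.Definitions using (Injective)
open import Function.Bundles using (_⇔_)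
open import Relation.Nullary using (¬_; yes; no)
open import Relation.Binary.PropositionalEquality using (_≡_; _≢_)

PVAR : Set
PVAR = ℕ

LOC : Set
LOC = ℕ

Store : Set
Store = PVAR → LOC

record Heap : Set where
  field
    fn     : LOC → Maybe LOC
    finite : ∃ λ (n : ℕ) → ∀ (l : LOC) → n ≤ l → fn l ≡ nothing
open Heap public

InDom : Heap → LOC → Set
InDom h l = ∃ λ (l' : LOC) → fn h l ≡ just l'

Split : Heap → Heap → Heap → Set
Split h h₁ h₂ = ∀ (l : LOC) →
  (fn h₁ l ≡ nothing × fn h l ≡ fn h₂ l) ⊎ (fn h₂ l ≡ nothing × fn h l ≡ fn h₁ l)

iter : Heap → ℕ → LOC → Maybe LOC
iter h zero    l = just l
iter h (suc n) l = iter h n l >>= fn h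

InMinpath : Heap → LOC → LOC → LOC → Set
InMinpath h l₁ l₂ l = Σ ℕ λ δ₁ → Σ ℕ λ δ₂ →
  1 ≤ δ₂ × iter h δ₁ l₁ ≡ just l × iter h δ₂ l ≡ just l₂ ×
  (∀ (δ : ℕ) → 1 ≤ δ → δ ≤ δ₁ + δ₂ ∸ 1 → iter h δ l₁ ≢ just l₂)

update : Store → PVAR → LOC → Store
update s z l v with v ≟ z
... | yes _ = l
... | no  _ = s v

data Form : Set where
  _≐_   : PVAR → PVAR → Form
  _↪_   : PVAR → PVAR → Form
  emp   : Form
  ¬ₛ_   : Form → Form
  _∧ₛ_  : Form → Form → Form
  _*ₛ_  : Form → Form → Form
  ∃⇝    : PVAR → PVAR → PVAR → Form → Form   -- ∃⇝ z x y φ  is  ∃ z : x ⇝ y  φ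

_,_⊨_ : Store → Heap → Form → Set
s , h ⊨ (x ≐ y)   = s x ≡ s y
s , h ⊨ (x ↪ y)   = fn h (s x) ≡ just (s y)
s , h ⊨ emp       = ∀ (l : LOC) → fn h l ≡ nothing
s , h ⊨ (¬ₛ φ)    = ¬ (s , h ⊨ φ)
s , h ⊨ (φ ∧ₛ ψ)  = (s , h ⊨ φ) × (s , h ⊨ ψ)
s , h ⊨ (φ *ₛ ψ)  = Σ Heap λ h₁ → Σ Heap λ h₂ →
                      Split h h₁ h₂ × (s , h₁ ⊨ φ) × (s , h₂ ⊨ ψ)
s , h ⊨ ∃⇝ z x y φ =
  (∃ λ (l : LOC) → InMinpath h (s x) (s y) l) ×
  (∃ λ (l : LOC) → (InMinpath h (s x) (s y) l ⊎ l ≡ s y) × (update s z l , h ⊨ φ))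

data Term : Set where
  var : PVAR → Term
  m   : PVAR → PVAR → PVAR → Term

-- ⟦ t ⟧_{s,h} is defined and equals ℓ
Den : Store → Heap → Term → LOC → Set
Den s h (var x) l = s x ≡ l
Den s h (m x y z) l = Σ ℕ λ δ₁ → Σ ℕ λ δ₂ →
  iter h δ₁ (s x) ≡ just l × iter h δ₂ (s y) ≡ just l ×
  (∃ λ (δ : ℕ) → iter h δ l ≡ just (s z)) ×
  (∀ (δ₁' : ℕ) → δ₁' < δ₁ → ∀ (δ₂' : ℕ) → ∀ (l' : LOC) →
     ¬ (iter h δ₁' (s x) ≡ just l' × iter h δ₂' (s y) ≡ just l'))

-- Core formulae; T and P are finite sets, given as lists.
data Core : Set where
  eqC   : Term → Term → Core
  seesC : List Term → Term → Term → ℕ → Core          -- seesC T t₁ t₂ β  is  sees_T(t₁,t₂) ≥ β+1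
  remC  : List (Term × Term) → ℕ → Core

Sees : Store → Heap → List Term → Term → Term → ℕ → Set
Sees s h T t₁ t₂ β = Σ LOC λ l₁ → Σ LOC λ l₂ → Den s h t₁ l₁ × Den s h t₂ l₂ ×
  Σ ℕ λ δ → β ≤ δ × iter h δ l₁ ≡ just l₂ ×
  (∀ (δ' : ℕ) → 1 ≤ δ' → δ' ≤ δ ∸ 1 → ∀ (l' : LOC) → iter h δ' l₁ ≡ just l' →
     l' ≢ l₂ × (∀ (t : Term) → t ∈ T → ¬ Den s h t l'))

Covered : Store → Heap → List (Term × Term) → LOC → Set
Covered s h P l = Σ Term λ t₁ → Σ Term λ t₂ → (t₁ , t₂) ∈ P ×
  Σ LOC λ l₁ → Σ LOC λ l₂ → Den s h t₁ l₁ × Den s h t₂ l₂ × InMinpath h l₁ l₂ l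

Rem : Store → Heap → List (Term × Term) → ℕ → Set
Rem s h P β = Σ (Vec LOC β) λ v → Injective _≡_ _≡_ (lookup v) ×
  (∀ (i : Fin β) → InDom h (lookup v i) × ¬ Covered s h P (lookup v i))

_,_⊨ᶜ_ : Store → Heap → Core → Set
s , h ⊨ᶜ eqC t₁ t₂ = ∃ λ (l : LOC) → Den s h t₁ l × Den s h t₂ l
s , h ⊨ᶜ seesC T t₁ t₂ β = Sees s h T t₁ t₂ (suc β)
s , h ⊨ᶜ remC P β = Rem s h P β

-- Reachability in the heap graph, first hits and minpaths are all expressible with ∃:⇝,
-- and so is the value of a term: the meet point of m(a,b,c) lies on the minpath from a
-- to c (or is c) and is the first point there reached from b, so ∃ w : a ⇝ c can bind
-- it to a fresh variable w. Once both terms are bound, t₁ = t₂ is an equality of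
-- variables and sees_T(t₁,t₂) ≥ β + 1 says that the first hit of t₂ from t₁ is at least
-- β + 1 steps away (walked with ↪) with no interior point of the minpath denoted by a
-- term of T. Finally rem_P ≥ β holds iff h = h₁ * h₂ where every pair of P whose first
-- value reaches the second still does so in h₁ and h₂ has β cells, written
-- (¬ emp) * … * (¬ emp): a minpath realised in h₁ lies in dom h₁, and conversely
-- removing uncovered cells breaks no minpath.
--
-- Negation and disjunction only yield double-negated facts constructively; they are
-- discharged by the decidability of star-free formulae and of rem_P ≥ β, both
-- consequences of heaps being finite.

module Submission where

open import Defs
open import Data.Bool using (Bool; true; false; if_then_else_)
open import Data.Fin using (Fin; zero; suc; toℕ; fromℕ<; inject≤)
open import Data.Fin.Properties
  using (pigeonhole; toℕ<n; toℕ-fromℕ<; inject≤-injective; injective⇒≤)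
  renaming (suc-injective to Fin-suc-injective)
open import Data.List as List using (List; []; _∷_)
open import Data.List.Membership.Propositional using (_∈_)
open import Data.List.Membership.Propositional.Properties using (∈-filter⁺; ∈-filter⁻; ∈-upTo⁺; ∈-lookup)
open import Data.List.Relation.Unary.All as All using (All; []; _∷_)
open import Data.List.Relation.Unary.Any as Any using (here; there)
import Data.List.Relation.Unary.Any.Properties as Anyₚ
open import Data.List.Relation.Unary.AllPairs using (_∷_)
open import Data.List.Relation.Unary.Unique.Propositional using (Unique)
import Data.List.Relation.Unary.Unique.Propositional.Properties as Uniqueₚ
open import Data.Maybe using (Maybe; just; nothing; _>>=_)
open import Data.Maybe.Properties as Maybe using (just-injective)
open import Data.Nat using (ℕ; zero; suc; _+_; _∸_; _⊔_; _≤_; _<_; _≟_; z≤n; s≤s; _≤?_)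
open import Data.Nat.Induction using (<-rec)
open import Data.Nat.Properties
open import Data.Product using (Σ; ∃; _×_; _,_; proj₁; proj₂)
open import Data.Sum using (_⊎_; inj₁; inj₂; swap)
open import Data.Vec as Vec using (Vec; []; _∷_; lookup)
open import Data.Vec.Membership.DecPropositional _≟_ using (_∈?_)
open import Data.Vec.Membership.Propositional.Properties using () renaming (∈-lookup to ∈-lookupᵥ)
open import Data.Vec.Properties using (lookup∘tabulate)
import Data.Vec.Relation.Unary.Any as Anyᵥ
import Data.Vec.Relation.Unary.Any.Properties as Anyᵥₚ
open import Function.Base using (_∘_)
open import Function.Bundles using (_⇔_; mk⇔)
open import Function.Definitions using (Injective)
open import Level using (0ℓ)
open import Relation.Binary.Definitions using (tri<; tri≈; tri>)
open import Relation.Binary.PropositionalEquality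
open import Relation.Nullary using (¬_; Dec; yes; no; does; contradiction; ¬?; _×-dec_)
open import Relation.Nullary.Decidable using (decidable-stable)
open import Relation.Unary using (Pred; Decidable)

≡just-unique : ∀ {A : Set} {mx : Maybe A} {a b} → mx ≡ just a → mx ≡ just b → a ≡ b
≡just-unique e₁ e₂ = just-injective (trans (sym e₁) e₂)

>>=-just⁻ : ∀ (mx : Maybe LOC) (f : LOC → Maybe LOC) {z} →
            (mx >>= f) ≡ just z → ∃ λ y → mx ≡ just y × f y ≡ just z
>>=-just⁻ (just y) f eq = y , refl , eq

iter-+ : ∀ h a b {x y} → iter h a x ≡ just y → iter h (a + b) x ≡ iter h b y
iter-+ h a zero    eq rewrite +-identityʳ a = eq
iter-+ h a (suc b) eq rewrite +-suc a b | iter-+ h a b eq = refl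

iter-prefix : ∀ h a b {x z} → iter h (a + b) x ≡ just z → ∃ λ y → iter h a x ≡ just y
iter-prefix h a zero    {z = z} eq rewrite +-identityʳ a = z , eq
iter-prefix h a (suc b) eq rewrite +-suc a b with >>=-just⁻ (iter h (a + b) _) (fn h) eq
... | y , e , _ = iter-prefix h a b e

iter-suc-front : ∀ h n x → iter h (suc n) x ≡ (fn h x >>= iter h n)
iter-suc-front h zero x with fn h x
... | just y  = refl
... | nothing = refl
iter-suc-front h (suc n) x rewrite iter-suc-front h n x with fn h x
... | just y  = refl
... | nothing = refl

iter-suc⁻ : ∀ h n {x y} → iter h (suc n) x ≡ just y →
            ∃ λ z → fn h x ≡ just z × iter h n z ≡ just y
iter-suc⁻ h n {x} e = >>=-just⁻ (fn h x) (iter h n) (trans (sym (iter-suc-front h n x)) e)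

iter≟ : ∀ h δ a b → Dec (iter h δ a ≡ just b)
iter≟ h δ a b = Maybe.≡-dec _≟_ (iter h δ a) (just b)

module _ {P : Pred ℕ 0ℓ} (P? : Decidable P) where

  leastBelow : ∀ n → (∃ λ k → k < n × P k × (∀ j → j < k → ¬ P j)) ⊎ (∀ k → k < n → ¬ P k)
  leastBelow zero = inj₂ λ _ ()
  leastBelow (suc n) with leastBelow n
  ... | inj₁ (k , k<n , p , min) = inj₁ (k , m<n⇒m<1+n k<n , p , min)
  ... | inj₂ none with P? n
  ...   | yes p = inj₁ (n , ≤-refl , p , none)
  ...   | no ¬p = inj₂ none′
    where
    none′ : ∀ k → k < suc n → ¬ P k
    none′ k k<1+n with m≤n⇒m<n∨m≡n (≤-pred k<1+n)
    ... | inj₁ k<n  = none k k<n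
    ... | inj₂ refl = ¬p

  least : ∀ {k} → P k → ∃ λ k′ → k′ ≤ k × P k′ × (∀ j → j < k′ → ¬ P j)
  least {k} p with leastBelow (suc k)
  ... | inj₁ (k′ , k′<1+k , p′ , min) = k′ , ≤-pred k′<1+k , p′ , min
  ... | inj₂ none = contradiction p (none k ≤-refl)

Hit : Heap → LOC → LOC → ℕ → Set
Hit h a b δ = 1 ≤ δ × iter h δ a ≡ just b

hit? : ∀ h a b → Decidable (Hit h a b)
hit? h a b zero    = no λ ()
hit? h a b (suc δ) with iter≟ h (suc δ) a b
... | yes e = yes (s≤s z≤n , e)
... | no ¬e = no λ (_ , e) → ¬e e

Reach : Heap → LOC → LOC → Set
Reach h a b = ∃ (Hit h a b)

Reach* : Heap → LOC → LOC → Set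
Reach* h a b = ∃ λ δ → iter h δ a ≡ just b

iter-≢⇒positive : ∀ {h δ a b} → iter h δ a ≡ just b → a ≢ b → 1 ≤ δ
iter-≢⇒positive {δ = zero}  e a≢b = contradiction (just-injective e) a≢b
iter-≢⇒positive {δ = suc _} _ _   = s≤s z≤n

FirstHit : Heap → LOC → LOC → ℕ → Set
FirstHit h a b δ = 1 ≤ δ × iter h δ a ≡ just b ×
  (∀ δ′ → 1 ≤ δ′ → δ′ ≤ δ ∸ 1 → iter h δ′ a ≢ just b)

≤∸1⇒< : ∀ {δ δ′} → 1 ≤ δ → δ′ ≤ δ ∸ 1 → δ′ < δ
≤∸1⇒< {suc δ} _ le = s≤s le

<⇒≤∸1 : ∀ {δ δ′} → δ′ < δ → δ′ ≤ δ ∸ 1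
<⇒≤∸1 {suc δ} (s≤s le) = le

Reach⇒FirstHit : ∀ {h a b} → Reach h a b → ∃ (FirstHit h a b)
Reach⇒FirstHit {h} {a} {b} (δ , hit) with least (hit? h a b) hit
... | d , _ , (1≤d , e) , min =
  d , 1≤d , e , λ δ′ 1≤δ′ le e′ → min δ′ (≤∸1⇒< 1≤d le) (1≤δ′ , e′)

FirstHit⇒Reach : ∀ {h a b d} → FirstHit h a b d → Reach h a b
FirstHit⇒Reach {d = d} (1≤d , e , _) = d , 1≤d , e

FirstHit-≤ : ∀ {h a b d δ} → FirstHit h a b d → 1 ≤ δ → iter h δ a ≡ just b → d ≤ δ
FirstHit-≤ {d = d} {δ} (_ , _ , first) 1≤δ e with d ≤? δ
... | yes d≤δ = d≤δ
... | no  d≰δ = contradiction e (first δ 1≤δ (<⇒≤∸1 (≰⇒> d≰δ)))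

FirstHit-unique : ∀ {h a b d d′} → FirstHit h a b d → FirstHit h a b d′ → d ≡ d′
FirstHit-unique f@(1≤d , e , _) f′@(1≤d′ , e′ , _) =
  ≤-antisym (FirstHit-≤ f 1≤d′ e′) (FirstHit-≤ f′ 1≤d e)

minpath⇒beforeFirstHit : ∀ {h a b l} → InMinpath h a b l →
  ∃ λ d → FirstHit h a b d × ∃ λ k → k < d × iter h k a ≡ just l
minpath⇒beforeFirstHit {h} (δ₁ , δ₂ , 1≤δ₂ , e₁ , e₂ , first) =
  δ₁ + δ₂ , (≤-trans 1≤δ₂ (m≤n+m δ₂ δ₁) , trans (iter-+ h δ₁ δ₂ e₁) e₂ , first) ,
  δ₁ , m<m+n δ₁ 1≤δ₂ , e₁

beforeFirstHit⇒minpath : ∀ {h a b l d k} → FirstHit h a b d → k < d → iter h k a ≡ just l →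
                         InMinpath h a b l
beforeFirstHit⇒minpath {h} {a} {b} {l} {d} {k} (_ , e , first) k<d eₖ =
  k , d ∸ k , m<n⇒0<n∸m k<d , eₖ , e′ , λ δ 1≤δ le → first δ 1≤δ (subst (λ x → δ ≤ x ∸ 1) k+[d∸k]≡d le)
  where
  k+[d∸k]≡d : k + (d ∸ k) ≡ d
  k+[d∸k]≡d = m+[n∸m]≡n (<⇒≤ k<d)
  e′ : iter h (d ∸ k) l ≡ just b
  e′ = begin
    iter h (d ∸ k) l       ≡⟨ iter-+ h k (d ∸ k) eₖ ⟨
    iter h (k + (d ∸ k)) a ≡⟨ cong (λ x → iter h x a) k+[d∸k]≡d ⟩
    iter h d a             ≡⟨ e ⟩
    just b                 ∎
    where open ≡-Reasoning

Reach⇒source∈minpath : ∀ {h a b} → Reach h a b → InMinpath h a b a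
Reach⇒source∈minpath r with Reach⇒FirstHit r
... | d , f@(1≤d , _) = beforeFirstHit⇒minpath f 1≤d refl

minpath⇒Reach : ∀ {h a b l} → InMinpath h a b l → Reach h a b
minpath⇒Reach mp with minpath⇒beforeFirstHit mp
... | d , f , _ = FirstHit⇒Reach f

FirstHit-suc⁺ : ∀ {h a b l δ} → fn h a ≡ just l → l ≢ b → FirstHit h l b δ → FirstHit h a b (suc δ)
FirstHit-suc⁺ {h} {a} {b} {l} {δ} e l≢b (_ , eδ , first) = s≤s z≤n , trans (iter-+ h 1 δ e) eδ , first′
  where
  first′ : ∀ δ′ → 1 ≤ δ′ → δ′ ≤ δ → iter h δ′ a ≢ just b
  first′ (suc zero)       _ _          e₁ = l≢b (≡just-unique e e₁)
  first′ (suc (suc δ′))   _ (s≤s le) e′ =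
    first (suc δ′) (s≤s z≤n) le (trans (sym (iter-+ h 1 (suc δ′) e)) e′)

FirstHit-suc⁻ : ∀ {h a b l δ} → fn h a ≡ just l → FirstHit h a b (suc δ) → 1 ≤ δ → l ≢ b × FirstHit h l b δ
FirstHit-suc⁻ {h} {a} {b} {l} {δ} e (_ , eδ , first) 1≤δ =
  (λ l≡b → first 1 (s≤s z≤n) 1≤δ (trans e (cong just l≡b))) ,
  1≤δ , trans (sym (iter-+ h 1 δ e)) eδ ,
  λ δ′ 1≤δ′ le e′ → first (suc δ′) (s≤s z≤n) (≤∸1⇒< 1≤δ le) (trans (iter-+ h 1 δ′ e) e′)

FirstHit-no-return : ∀ {h a b δ δ′} → FirstHit h a b δ → 1 ≤ δ′ → δ′ ≤ δ ∸ 1 → iter h δ′ a ≢ just a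
FirstHit-no-return {h} {a} {b} {δ} {δ′} (1≤δ , e , first) 1≤δ′ le e′ =
  first (δ ∸ δ′) (m<n⇒0<n∸m δ′<δ) (∸-monoʳ-≤ δ 1≤δ′) (begin
    iter h (δ ∸ δ′) a        ≡⟨ iter-+ h δ′ (δ ∸ δ′) e′ ⟨
    iter h (δ′ + (δ ∸ δ′)) a ≡⟨ cong (λ x → iter h x a) (m+[n∸m]≡n (<⇒≤ δ′<δ)) ⟩
    iter h δ a               ≡⟨ e ⟩
    just b                   ∎)
  where
  open ≡-Reasoning
  δ′<δ : δ′ < δ
  δ′<δ = ≤∸1⇒< 1≤δ le

-- Reachability is decidable

bound : Heap → ℕ
bound h = proj₁ (finite h)

dom<bound : ∀ h {l z} → fn h l ≡ just z → l < bound h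
dom<bound h {l} e with bound h ≤? l
... | yes le = contradiction (trans (sym e) (proj₂ (finite h) l le)) λ ()
... | no  le = ≰⇒> le

InDom⇒<bound : ∀ h {l} → InDom h l → l < bound h
InDom⇒<bound h (_ , e) = dom<bound h e

iter-before-defined : ∀ h {a δ k l} → k < δ → iter h δ a ≡ just l →
                      ∃ λ p → iter h k a ≡ just p × InDom h p
iter-before-defined h {a} {δ} {k} k<δ e
  with iter-prefix h (suc k) (δ ∸ suc k) (subst (λ x → iter h x a ≡ _) (sym (m+[n∸m]≡n k<δ)) e)
... | z , e′ with >>=-just⁻ (iter h k a) (fn h) e′
... | p , eₚ , fₚ = p , eₚ , z , fₚ

iter-skip-loop : ∀ h {a i j δ p l} → iter h i a ≡ just p → iter h j a ≡ just p → j ≤ δ →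
                 iter h δ a ≡ just l → iter h (i + (δ ∸ j)) a ≡ just l
iter-skip-loop h {a} {i} {j} {δ} {p} {l} eᵢ eⱼ j≤δ e = begin
  iter h (i + (δ ∸ j)) a ≡⟨ iter-+ h i (δ ∸ j) eᵢ ⟩
  iter h (δ ∸ j) p       ≡⟨ iter-+ h j (δ ∸ j) eⱼ ⟨
  iter h (j + (δ ∸ j)) a ≡⟨ cong (λ x → iter h x a) (m+[n∸m]≡n j≤δ) ⟩
  iter h δ a             ≡⟨ e ⟩
  just l                 ∎
  where open ≡-Reasoning

module _ (h : Heap) {a δ l} (N<δ : bound h < δ) (e : iter h δ a ≡ just l) where

  private
    position : (i : Fin (suc (bound h))) → ∃ λ p → iter h (toℕ i) a ≡ just p × InDom h p
    position i = iter-before-defined h (≤-<-trans (≤-pred (toℕ<n i)) N<δ) e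

    location<bound : ∀ i → proj₁ (position i) < bound h
    location<bound i = InDom⇒<bound h (proj₂ (proj₂ (position i)))

    location : Fin (suc (bound h)) → Fin (bound h)
    location i = fromℕ< (location<bound i)

    shortcut : ∀ {i j} → toℕ i < toℕ j → location i ≡ location j → ∃ λ δ′ → δ′ < δ × iter h δ′ a ≡ just l
    shortcut {i} {j} i<j same =
      toℕ i + (δ ∸ toℕ j) ,
      subst (toℕ i + (δ ∸ toℕ j) <_) (m+[n∸m]≡n j≤δ) (+-monoˡ-< (δ ∸ toℕ j) i<j) ,
      iter-skip-loop h {i = toℕ i} (proj₁ (proj₂ (position i))) eⱼ j≤δ e
      where
      j≤δ : toℕ j ≤ δ
      j≤δ = ≤-trans (≤-pred (toℕ<n j)) (<⇒≤ N<δ)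
      same-location : proj₁ (position j) ≡ proj₁ (position i)
      same-location = trans (sym (toℕ-fromℕ< (location<bound j))) (trans (cong toℕ (sym same)) (toℕ-fromℕ< (location<bound i)))
      eⱼ : iter h (toℕ j) a ≡ just (proj₁ (position i))
      eⱼ = subst (λ p → iter h (toℕ j) a ≡ just p) same-location (proj₁ (proj₂ (position j)))

  -- Two of the positions 0, …, bound h lie on the same cell: skip the loop between them.
  iter-shorten : ∃ λ δ′ → δ′ < δ × iter h δ′ a ≡ just l
  iter-shorten = let (i , j , i<j , same) = pigeonhole (n<1+n (bound h)) location in shortcut i<j same

iter-≤bound : ∀ h {a} δ {l} → iter h δ a ≡ just l → ∃ λ δ′ → δ′ ≤ bound h × iter h δ′ a ≡ just l
iter-≤bound h {a} = <-rec Shortcut go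
  where
  Shortcut : ℕ → Set
  Shortcut δ = ∀ {l} → iter h δ a ≡ just l → ∃ λ δ′ → δ′ ≤ bound h × iter h δ′ a ≡ just l
  go : ∀ δ → (∀ {δ′} → δ′ < δ → Shortcut δ′) → Shortcut δ
  go δ rec e with δ ≤? bound h
  ... | yes δ≤N = δ , δ≤N , e
  ... | no  δ≰N = let (δ′ , δ′<δ , e′) = iter-shorten h (≰⇒> δ≰N) e in rec δ′<δ e′

-- After its first step a path can be shortened to at most bound h further steps.
Reach? : ∀ h a b → Dec (Reach h a b)
Reach? h a b with anyUpTo? (hit? h a b) (2 + bound h)
... | yes (δ , _ , hit) = yes (δ , hit)
... | no none = no λ where
  (suc k , _ , e) → let (a₁ , e₁ , eₖ) = iter-suc⁻ h k e
                        (k′ , k′≤N , eₖ′) = iter-≤bound h k eₖ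
                    in none (suc k′ , s≤s (s≤s k′≤N) , s≤s z≤n ,
                             trans (iter-suc-front h k′ a) (subst (λ x → (x >>= iter h k′) ≡ just b) (sym e₁) eₖ′))

-- Star-free formulae are decidable

update-≡ : ∀ s z l → update s z l z ≡ l
update-≡ s z l with z ≟ z
... | yes _  = refl
... | no z≢z = contradiction refl z≢z

update-≢ : ∀ s z l {x} → x ≢ z → update s z l x ≡ s x
update-≢ s z l {x} x≢z with x ≟ z
... | yes x≡z = contradiction x≡z x≢z
... | no _    = refl

data StarFree : Form → Set where
  sf-≐   : ∀ x y → StarFree (x ≐ y)
  sf-↪   : ∀ x y → StarFree (x ↪ y)
  sf-emp : StarFree emp
  sf-¬   : ∀ {φ} → StarFree φ → StarFree (¬ₛ φ)
  sf-∧   : ∀ {φ ψ} → StarFree φ → StarFree ψ → StarFree (φ ∧ₛ ψ)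
  sf-∃⇝  : ∀ {φ} z x y → StarFree φ → StarFree (∃⇝ z x y φ)

emp? : ∀ h → Dec (∀ l → fn h l ≡ nothing)
emp? h with allUpTo? (λ l → Maybe.≡-dec _≟_ (fn h l) nothing) (bound h)
... | no ¬below = no λ empty → ¬below λ {l} _ → empty l
... | yes below = yes free
  where
  free : ∀ l → fn h l ≡ nothing
  free l with bound h ≤? l
  ... | yes N≤l = proj₂ (finite h) l N≤l
  ... | no  N≰l = below (≰⇒> N≰l)

∃⇝? : ∀ s h z x y ψ → (∀ l → Dec (update s z l , h ⊨ ψ)) → Dec (s , h ⊨ ∃⇝ z x y ψ)
∃⇝? s h z x y ψ ψ? with Reach? h (s x) (s y)
... | no ¬r = no λ ((_ , mp) , _) → ¬r (minpath⇒Reach mp)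
... | yes r with Reach⇒FirstHit r
... | d , f with anyUpTo? onPath? d
  where
  onPath? : Decidable (λ k → ∃ λ l → iter h k (s x) ≡ just l × (update s z l , h ⊨ ψ))
  onPath? k with iter h k (s x)
  ... | nothing = no λ { (_ , () , _) }
  ... | just l with ψ? l
  ...   | yes p = yes (l , refl , p)
  ...   | no ¬p = no λ (l′ , e , p) → ¬p (subst (λ q → update s z q , h ⊨ ψ) (sym (just-injective e)) p)
... | yes (k , k<d , l , e , p) = yes ((s x , Reach⇒source∈minpath r) , l , inj₁ (beforeFirstHit⇒minpath f k<d e) , p)
... | no none with ψ? (s y)
...   | yes p = yes ((s x , Reach⇒source∈minpath r) , s y , inj₂ refl , p)
...   | no ¬p = no λ where
  (_ , _ , inj₂ refl , p) → ¬p p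
  (_ , l , inj₁ mp , p) → let (d′ , f′ , k , k<d′ , e) = minpath⇒beforeFirstHit mp
                          in none (k , subst (k <_) (FirstHit-unique f′ f) k<d′ , l , e , p)

⊨? : ∀ {φ} → StarFree φ → ∀ s h → Dec (s , h ⊨ φ)
⊨? (sf-≐ x y)       s h = s x ≟ s y
⊨? (sf-↪ x y)       s h = iter≟ h 1 (s x) (s y)
⊨? sf-emp           s h = emp? h
⊨? (sf-¬ φ)         s h = ¬? (⊨? φ s h)
⊨? (sf-∧ φ ψ)       s h = ⊨? φ s h ×-dec ⊨? ψ s h
⊨? (sf-∃⇝ z x y φ)  s h = ∃⇝? s h z x y _ (λ l → ⊨? φ (update s z l) h)

⊤ₛ : Form
⊤ₛ = ¬ₛ (¬ₛ (0 ≐ 0))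

sf-⊤ : StarFree ⊤ₛ
sf-⊤ = sf-¬ (sf-¬ (sf-≐ 0 0))

⊤ₛ-intro : ∀ s h → s , h ⊨ ⊤ₛ
⊤ₛ-intro s h ¬refl = ¬refl refl

_∨ₛ_ : Form → Form → Form
φ ∨ₛ ψ = ¬ₛ ((¬ₛ φ) ∧ₛ (¬ₛ ψ))

sf-∨ : ∀ {φ ψ} → StarFree φ → StarFree ψ → StarFree (φ ∨ₛ ψ)
sf-∨ φ ψ = sf-¬ (sf-∧ (sf-¬ φ) (sf-¬ ψ))

∨ₛ-introˡ : ∀ s h φ ψ → s , h ⊨ φ → s , h ⊨ (φ ∨ₛ ψ)
∨ₛ-introˡ s h φ ψ p (¬p , _) = ¬p p

∨ₛ-introʳ : ∀ s h φ ψ → s , h ⊨ ψ → s , h ⊨ (φ ∨ₛ ψ)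
∨ₛ-introʳ s h φ ψ q (_ , ¬q) = ¬q q

∨ₛ-elim : ∀ s h φ ψ → Dec (s , h ⊨ φ) → Dec (s , h ⊨ ψ) →
          s , h ⊨ (φ ∨ₛ ψ) → (s , h ⊨ φ) ⊎ (s , h ⊨ ψ)
∨ₛ-elim s h φ ψ (yes p) _       _ = inj₁ p
∨ₛ-elim s h φ ψ (no _)  (yes q) _ = inj₂ q
∨ₛ-elim s h φ ψ (no ¬p) (no ¬q) o = contradiction (¬p , ¬q) o

reachₛ : PVAR → PVAR → Form
reachₛ x y = ∃⇝ 0 x y ⊤ₛ

sf-reach : ∀ x y → StarFree (reachₛ x y)
sf-reach x y = sf-∃⇝ 0 x y sf-⊤

reachₛ-sound : ∀ s h x y → s , h ⊨ reachₛ x y → Reach h (s x) (s y)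
reachₛ-sound s h x y ((_ , mp) , _) = minpath⇒Reach mp

reachₛ-complete : ∀ s h x y → Reach h (s x) (s y) → s , h ⊨ reachₛ x y
reachₛ-complete s h x y r =
  (s x , Reach⇒source∈minpath r) , s x , inj₁ (Reach⇒source∈minpath r) , ⊤ₛ-intro (update s 0 (s x)) h

reach*ₛ : PVAR → PVAR → Form
reach*ₛ x y = (x ≐ y) ∨ₛ reachₛ x y

sf-reach* : ∀ x y → StarFree (reach*ₛ x y)
sf-reach* x y = sf-∨ (sf-≐ x y) (sf-reach x y)

reach*ₛ-sound : ∀ s h x y → s , h ⊨ reach*ₛ x y → Reach* h (s x) (s y)
reach*ₛ-sound s h x y o with ∨ₛ-elim s h (x ≐ y) (reachₛ x y) (⊨? (sf-≐ x y) s h) (⊨? (sf-reach x y) s h) o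
... | inj₁ eq = 0 , cong just eq
... | inj₂ r  = let (δ , _ , e) = reachₛ-sound s h x y r in δ , e

reach*ₛ-complete : ∀ s h x y → Reach* h (s x) (s y) → s , h ⊨ reach*ₛ x y
reach*ₛ-complete s h x y (zero , e)  = ∨ₛ-introˡ s h (x ≐ y) (reachₛ x y) (just-injective e)
reach*ₛ-complete s h x y (suc δ , e) = ∨ₛ-introʳ s h (x ≐ y) (reachₛ x y) (reachₛ-complete s h x y (suc δ , s≤s z≤n , e))

-- Terms and meet points

VarsBelow : Term → ℕ → Set
VarsBelow (var x)   w = x < w
VarsBelow (m a b c) w = a < w × b < w × c < w

VarsBelow-mono : ∀ t {w w′} → VarsBelow t w → w ≤ w′ → VarsBelow t w′
VarsBelow-mono (var x)   x<w              le = <-≤-trans x<w le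
VarsBelow-mono (m a b c) (a<w , b<w , c<w) le = <-≤-trans a<w le , <-≤-trans b<w le , <-≤-trans c<w le

varBound : Term → ℕ
varBound (var x)   = suc x
varBound (m a b c) = suc (a ⊔ b ⊔ c)

VarsBelow-varBound : ∀ t → VarsBelow t (varBound t)
VarsBelow-varBound (var x)   = ≤-refl
VarsBelow-varBound (m a b c) =
  s≤s (≤-trans (m≤m⊔n a b) (m≤m⊔n (a ⊔ b) c)) ,
  s≤s (≤-trans (m≤n⊔m a b) (m≤m⊔n (a ⊔ b) c)) ,
  s≤s (m≤n⊔m (a ⊔ b) c)

varsBound : List Term → ℕ
varsBound []      = 0
varsBound (t ∷ T) = varBound t ⊔ varsBound T

All-VarsBelow-mono : ∀ {T w w′} → w ≤ w′ → All (λ t → VarsBelow t w) T → All (λ t → VarsBelow t w′) T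
All-VarsBelow-mono {T} w≤w′ = All.map (λ {t} tv → VarsBelow-mono t tv w≤w′)

VarsBelow-varsBound : ∀ T → All (λ t → VarsBelow t (varsBound T)) T
VarsBelow-varsBound []      = []
VarsBelow-varsBound (t ∷ T) =
  VarsBelow-mono t (VarsBelow-varBound t) (m≤m⊔n (varBound t) (varsBound T)) ∷
  All-VarsBelow-mono (m≤n⊔m (varBound t) (varsBound T)) (VarsBelow-varsBound T)

Agree : ℕ → Store → Store → Set
Agree w s s′ = ∀ {x} → x < w → s x ≡ s′ x

Agree-refl : ∀ w s → Agree w s s
Agree-refl w s _ = refl

Agree-sym : ∀ {w s s′} → Agree w s s′ → Agree w s′ s
Agree-sym ag x<w = sym (ag x<w)

Agree-trans : ∀ {w w′ s s′ s″} → w ≤ w′ → Agree w s s′ → Agree w′ s′ s″ → Agree w s s″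
Agree-trans w≤w′ ag ag′ x<w = trans (ag x<w) (ag′ (<-≤-trans x<w w≤w′))

Agree-update : ∀ {w z} s l → w ≤ z → Agree w s (update s z l)
Agree-update {z = z} s l w≤z x<w = sym (update-≢ s z l (<⇒≢ (<-≤-trans x<w w≤z)))

-- Den s h (m a b c) l unfolds to Meet h (s a) (s b) (s c) l.
Meet : Heap → LOC → LOC → LOC → LOC → Set
Meet h A B C l = Σ ℕ λ δ₁ → Σ ℕ λ δ₂ →
  iter h δ₁ A ≡ just l × iter h δ₂ B ≡ just l ×
  (∃ λ (δ : ℕ) → iter h δ l ≡ just C) ×
  (∀ (δ₁′ : ℕ) → δ₁′ < δ₁ → ∀ (δ₂′ : ℕ) → ∀ (l′ : LOC) →
     ¬ (iter h δ₁′ A ≡ just l′ × iter h δ₂′ B ≡ just l′))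

Den-agree : ∀ {w s s′ h l} t → VarsBelow t w → Agree w s s′ → Den s h t l → Den s′ h t l
Den-agree (var x) x<w ag d = trans (sym (ag x<w)) d
Den-agree {h = h} {l} (m a b c) (a<w , b<w , c<w) ag d =
  subst (λ C → Meet h _ _ C l) (ag c<w) (subst (λ B → Meet h _ B _ l) (ag b<w) (subst (λ A → Meet h A _ _ l) (ag a<w) d))

Den-unique : ∀ {s h} t {l l′} → Den s h t l → Den s h t l′ → l ≡ l′
Den-unique (var x) d d′ = trans (sym d) d′
Den-unique (m a b c) (δ₁ , δ₂ , e₁ , e₂ , _ , first) (δ₁′ , δ₂′ , e₁′ , e₂′ , _ , first′)
  with <-cmp δ₁ δ₁′
... | tri< lt _ _   = contradiction (e₁ , e₂) (first′ δ₁ lt δ₂ _)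
... | tri≈ _ refl _ = ≡just-unique e₁ e₁′
... | tri> _ _ gt   = contradiction (e₁′ , e₂′) (first δ₁′ gt δ₂′ _)

EarlyMeet : Heap → LOC → LOC → LOC → Set
EarlyMeet h A B Q = ∃ λ l → InMinpath h A Q l × l ≢ Q × Reach* h B l

meet-intro : ∀ {h A B C Q} → Reach* h A Q → Reach* h B Q → Reach* h Q C →
             ¬ (A ≢ Q × EarlyMeet h A B Q) → Meet h A B C Q
meet-intro {h} {A} {B} {C} {Q} (δ , hitA) (δ₂ , e₂) reachC noEarly
  with least (λ k → iter≟ h k A Q) {δ} hitA
... | δ₁ , _ , e₁ , min = δ₁ , δ₂ , e₁ , e₂ , reachC , early
  where
  early : ∀ δ₁′ → δ₁′ < δ₁ → ∀ δ₂′ l′ → ¬ (iter h δ₁′ A ≡ just l′ × iter h δ₂′ B ≡ just l′)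
  early δ₁′ δ₁′<δ₁ δ₂′ l′ (e₁′ , e₂′) =
    noEarly (A≢Q , l′ , beforeFirstHit⇒minpath first δ₁′<δ₁ e₁′ , l′≢Q , δ₂′ , e₂′)
    where
    1≤δ₁ : 1 ≤ δ₁
    1≤δ₁ = <-≤-trans (s≤s z≤n) δ₁′<δ₁
    A≢Q : A ≢ Q
    A≢Q A≡Q = min 0 1≤δ₁ (cong just A≡Q)
    l′≢Q : l′ ≢ Q
    l′≢Q l′≡Q = min δ₁′ δ₁′<δ₁ (trans e₁′ (cong just l′≡Q))
    first : FirstHit h A Q δ₁
    first = 1≤δ₁ , e₁ , λ δ′ _ le → min δ′ (≤∸1⇒< 1≤δ₁ le)

meet-no-early : ∀ {h A B C Q} → Meet h A B C Q → ¬ (A ≢ Q × EarlyMeet h A B Q)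
meet-no-early {h} (δ₁ , _ , e₁ , _ , _ , early) (A≢Q , l′ , mp , _ , δ₂′ , e₂′)
  with minpath⇒beforeFirstHit mp
... | d , first , k , k<d , eₖ = early k (<-≤-trans k<d (FirstHit-≤ first 1≤δ₁ e₁)) δ₂′ l′ (eₖ , e₂′)
  where
  1≤δ₁ = iter-≢⇒positive e₁ A≢Q

meet-at-target : ∀ {h A B C l} → Meet h A B C l → A ≡ C → l ≡ C
meet-at-target (zero , _ , e₁ , _) A≡C = trans (sym (just-injective e₁)) A≡C
meet-at-target {h} {A} {l = l} (suc δ₁ , δ₂ , e₁ , e₂ , (δ , e) , early) A≡C =
  contradiction (refl , trans (iter-+ h δ₂ δ e₂) (trans e (cong just (sym A≡C)))) (early 0 (s≤s z≤n) (δ₂ + δ) A)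

meet∈minpath : ∀ {h A B C l} → Meet h A B C l → A ≢ C → Reach h A C × (InMinpath h A C l ⊎ l ≡ C)
meet∈minpath {h} {A} {B} {C} {l} (δ₁ , δ₂ , e₁ , e₂ , (δ , e) , early) A≢C =
  reach , position (Reach⇒FirstHit reach)
  where
  e′ = trans (iter-+ h δ₁ δ e₁) e
  reach : Reach h A C
  reach = δ₁ + δ , iter-≢⇒positive e′ A≢C , e′
  position : ∃ (FirstHit h A C) → InMinpath h A C l ⊎ l ≡ C
  position (d , first@(_ , e_d , _)) with <-cmp δ₁ d
  ... | tri< δ₁<d _ _ = inj₁ (beforeFirstHit⇒minpath first δ₁<d e₁)
  ... | tri≈ _ refl _ = inj₂ (≡just-unique e₁ e_d)
  ... | tri> _ _ d<δ₁ = contradiction (e_d , trans (iter-+ h δ₂ δ e₂) e) (early d d<δ₁ (δ₂ + δ) C)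

earlyₛ : PVAR → PVAR → PVAR → Form
earlyₛ a b q = ∃⇝ (suc q) a q ((¬ₛ (suc q ≐ q)) ∧ₛ reach*ₛ b (suc q))

module _ (s : Store) (h : Heap) (a b q : PVAR) (b<q : b < q) where

  private
    s[_] : LOC → Store
    s[ l ] = update s (suc q) l

    at-scratch : ∀ l → s[ l ] (suc q) ≡ l
    at-scratch l = update-≡ s (suc q) l

    at-q : ∀ l → s[ l ] q ≡ s q
    at-q l = update-≢ s (suc q) l (<⇒≢ (n<1+n q))

    at-b : ∀ l → s[ l ] b ≡ s b
    at-b l = update-≢ s (suc q) l (<⇒≢ (m<n⇒m<1+n b<q))

  earlyₛ-sound : s , h ⊨ earlyₛ a b q → EarlyMeet h (s a) (s b) (s q)
  earlyₛ-sound (_ , l , inj₂ l≡q , l≢q , _) = contradiction (trans (at-scratch l) (trans l≡q (sym (at-q l)))) l≢q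
  earlyₛ-sound (_ , l , inj₁ mp , l≢q , r) =
    l , mp , (λ l≡q → l≢q (trans (at-scratch l) (trans l≡q (sym (at-q l))))) ,
    subst₂ (Reach* h) (at-b l) (at-scratch l) (reach*ₛ-sound s[ l ] h b (suc q) r)

  earlyₛ-complete : EarlyMeet h (s a) (s b) (s q) → s , h ⊨ earlyₛ a b q
  earlyₛ-complete (l , mp , l≢q , r) =
    (s a , Reach⇒source∈minpath (minpath⇒Reach mp)) , l , inj₁ mp ,
    (λ eq → l≢q (trans (sym (at-scratch l)) (trans eq (at-q l)))) ,
    reach*ₛ-complete s[ l ] h b (suc q) (subst₂ (Reach* h) (sym (at-b l)) (sym (at-scratch l)) r)

denotesₛ : Term → PVAR → Form
denotesₛ (var x)   q = x ≐ q
denotesₛ (m a b c) q =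
  reach*ₛ a q ∧ₛ (reach*ₛ b q ∧ₛ (reach*ₛ q c ∧ₛ (¬ₛ ((¬ₛ (a ≐ q)) ∧ₛ earlyₛ a b q))))

sf-denotes : ∀ t q → StarFree (denotesₛ t q)
sf-denotes (var x)   q = sf-≐ x q
sf-denotes (m a b c) q =
  sf-∧ (sf-reach* a q) (sf-∧ (sf-reach* b q) (sf-∧ (sf-reach* q c)
    (sf-¬ (sf-∧ (sf-¬ (sf-≐ a q)) (sf-∃⇝ (suc q) a q (sf-∧ (sf-¬ (sf-≐ (suc q) q)) (sf-reach* b (suc q))))))))

denotesₛ-sound : ∀ s h t q → VarsBelow t q → s , h ⊨ denotesₛ t q → Den s h t (s q)
denotesₛ-sound s h (var x)   q _ x≡q = x≡q
denotesₛ-sound s h (m a b c) q (_ , b<q , _) (ra , rb , rc , noEarly) =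
  meet-intro (reach*ₛ-sound s h a q ra) (reach*ₛ-sound s h b q rb) (reach*ₛ-sound s h q c rc)
    λ (a≢q , early) → noEarly (a≢q , earlyₛ-complete s h a b q b<q early)

denotesₛ-complete : ∀ s h t q → VarsBelow t q → Den s h t (s q) → s , h ⊨ denotesₛ t q
denotesₛ-complete s h (var x)   q _ x≡q = x≡q
denotesₛ-complete s h (m a b c) q (_ , b<q , _) d@(δ₁ , δ₂ , e₁ , e₂ , reachC , _) =
  reach*ₛ-complete s h a q (δ₁ , e₁) , reach*ₛ-complete s h b q (δ₂ , e₂) , reach*ₛ-complete s h q c reachC ,
  λ (a≢q , early) → meet-no-early d (a≢q , earlyₛ-sound s h a b q b<q early)

meetAtTargetₛ : PVAR → PVAR → PVAR → (PVAR → Form) → Form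
meetAtTargetₛ a b c φ = (a ≐ c) ∧ₛ (reach*ₛ b c ∧ₛ φ c)

meetOnPathₛ : PVAR → PVAR → PVAR → PVAR → (PVAR → Form) → Form
meetOnPathₛ a b c w φ = (¬ₛ (a ≐ c)) ∧ₛ ∃⇝ w a c (denotesₛ (m a b c) w ∧ₛ φ w)

-- If a ≠ c the meet point of m(a,b,c) lies on the minpath from a to c or is c
-- (meet∈minpath), which is exactly the range of ∃ w : a ⇝ c.
letₛ : Term → PVAR → (PVAR → Form) → Form
letₛ (var x)   w φ = φ x
letₛ (m a b c) w φ = meetAtTargetₛ a b c φ ∨ₛ meetOnPathₛ a b c w φ

sf-let : ∀ t w φ → (∀ x → StarFree (φ x)) → StarFree (letₛ t w φ)
sf-let (var x)   w φ sf-φ = sf-φ x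
sf-let (m a b c) w φ sf-φ =
  sf-∨ (sf-∧ (sf-≐ a c) (sf-∧ (sf-reach* b c) (sf-φ c)))
       (sf-∧ (sf-¬ (sf-≐ a c)) (sf-∃⇝ w a c (sf-∧ (sf-denotes (m a b c) w) (sf-φ w))))

-- x < w when the value is already held by a variable of the term, x = w when letₛ
-- binds it afresh.
Witness : Store → Heap → PVAR → (PVAR → Form) → LOC → Set
Witness s h w φ l = ∃ λ s′ → ∃ λ x → Agree w s s′ × x ≤ w × s′ x ≡ l × (s′ , h ⊨ φ x)

Everywhere : Store → Heap → PVAR → (PVAR → Form) → LOC → Set
Everywhere s h w φ l = ∀ s′ x → Agree w s s′ → x ≤ w → s′ x ≡ l → s′ , h ⊨ φ x

module _ (s : Store) (h : Heap) (w : PVAR) (φ : PVAR → Form) where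

  letₛ-meet-sound : ∀ a b c → VarsBelow (m a b c) w →
    (s , h ⊨ meetAtTargetₛ a b c φ) ⊎ (s , h ⊨ meetOnPathₛ a b c w φ) →
    ∃ λ l → Den s h (m a b c) l × Witness s h w φ l
  letₛ-meet-sound a b c (_ , _ , c<w) (inj₁ (a≡c , rb , p)) =
    let (δ₂ , e₂) = reach*ₛ-sound s h b c rb in
    s c , (0 , δ₂ , cong just a≡c , e₂ , (0 , refl) , λ _ ()) , s , c , Agree-refl w s , <⇒≤ c<w , refl , p
  letₛ-meet-sound a b c tv (inj₂ (_ , _ , l , _ , is , p)) =
    l , Den-agree (m a b c) tv (Agree-sym (Agree-update s l ≤-refl)) d ,
    update s w l , w , Agree-update s l ≤-refl , ≤-refl , update-≡ s w l , p
    where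
    d : Den (update s w l) h (m a b c) l
    d = subst (Den (update s w l) h (m a b c)) (update-≡ s w l) (denotesₛ-sound (update s w l) h (m a b c) w tv is)

  letₛ-sound : ∀ t → (∀ x → StarFree (φ x)) → VarsBelow t w → s , h ⊨ letₛ t w φ →
               ∃ λ l → Den s h t l × Witness s h w φ l
  letₛ-sound (var x)   _    x<w p = s x , refl , s , x , Agree-refl w s , <⇒≤ x<w , refl , p
  letₛ-sound (m a b c) sf-φ tv  o =
    letₛ-meet-sound a b c tv
      (∨ₛ-elim s h (meetAtTargetₛ a b c φ) (meetOnPathₛ a b c w φ) (⊨? sf-at s h) (⊨? sf-on s h) o)
    where
    sf-at = sf-∧ (sf-≐ a c) (sf-∧ (sf-reach* b c) (sf-φ c))
    sf-on = sf-∧ (sf-¬ (sf-≐ a c)) (sf-∃⇝ w a c (sf-∧ (sf-denotes (m a b c) w) (sf-φ w)))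

  letₛ-sound¬¬ : ∀ t → VarsBelow t w → s , h ⊨ letₛ t w φ → ¬ ¬ (∃ λ l → Den s h t l × Witness s h w φ l)
  letₛ-sound¬¬ (var x)   x<w p k = k (s x , refl , s , x , Agree-refl w s , <⇒≤ x<w , refl , p)
  letₛ-sound¬¬ (m a b c) tv  o k = o ((λ at → k (letₛ-meet-sound a b c tv (inj₁ at))) ,
                                       (λ on → k (letₛ-meet-sound a b c tv (inj₂ on))))

  letₛ-complete : ∀ t {l} → VarsBelow t w → Den s h t l → Everywhere s h w φ l → s , h ⊨ letₛ t w φ
  letₛ-complete (var x) x<w d holds = holds s x (Agree-refl w s) (<⇒≤ x<w) d
  letₛ-complete (m a b c) {l} tv@(_ , _ , c<w) d holds with s a ≟ s c
  ... | yes a≡c =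
    ∨ₛ-introˡ s h (meetAtTargetₛ a b c φ) (meetOnPathₛ a b c w φ)
      (a≡c , reach*ₛ-complete s h b c (δ₂ , subst (λ v → iter h δ₂ (s b) ≡ just v) l≡c e₂) ,
       holds s c (Agree-refl w s) (<⇒≤ c<w) (sym l≡c))
    where
    l≡c = meet-at-target d a≡c
    δ₂ = proj₁ (proj₂ d)
    e₂ = proj₁ (proj₂ (proj₂ (proj₂ d)))
  ... | no a≢c =
    let (r , onPath) = meet∈minpath d a≢c in
    ∨ₛ-introʳ s h (meetAtTargetₛ a b c φ) (meetOnPathₛ a b c w φ)
      (a≢c , (s a , Reach⇒source∈minpath r) , l , onPath ,
       denotesₛ-complete s′ h (m a b c) w tv (subst (Den s′ h (m a b c)) (sym (update-≡ s w l)) (Den-agree (m a b c) tv ag d)) ,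
       holds s′ w ag ≤-refl (update-≡ s w l))
    where
    s′ = update s w l
    ag = Agree-update s l ≤-refl

-- letₛ t w also uses w + 1 as scratch variable of denotesₛ t w, so let2ₛ t₁ t₂ w
-- occupies the variables w, …, w + 3.
let2ₛ : Term → Term → PVAR → (PVAR → PVAR → Form) → Form
let2ₛ t₁ t₂ w ψ = letₛ t₁ w (λ u → letₛ t₂ (w + 2) (ψ u))

Witness₂ : Store → Heap → PVAR → (PVAR → PVAR → Form) → LOC → LOC → Set
Witness₂ s h w ψ l₁ l₂ = ∃ λ s′ → ∃ λ u → ∃ λ v →
  Agree w s s′ × u ≤ w × v ≤ w + 2 × s′ u ≡ l₁ × s′ v ≡ l₂ × (s′ , h ⊨ ψ u v)

Everywhere₂ : Store → Heap → PVAR → (PVAR → PVAR → Form) → LOC → LOC → Set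
Everywhere₂ s h w ψ l₁ l₂ = ∀ s′ u v →
  Agree w s s′ → u ≤ w → v ≤ w + 2 → s′ u ≡ l₁ → s′ v ≡ l₂ → s′ , h ⊨ ψ u v

Denote₂ : Store → Heap → Term → Term → (LOC → LOC → Set) → Set
Denote₂ s h t₁ t₂ Q = ∃ λ l₁ → ∃ λ l₂ → Den s h t₁ l₁ × Den s h t₂ l₂ × Q l₁ l₂

module _ (s : Store) (h : Heap) (w : PVAR) (ψ : PVAR → PVAR → Form)
         (t₁ t₂ : Term) (tv₁ : VarsBelow t₁ w) (tv₂ : VarsBelow t₂ w) where

  private
    w≤w+2 : w ≤ w + 2
    w≤w+2 = m≤m+n w 2

    tv₂′ : VarsBelow t₂ (w + 2)
    tv₂′ = VarsBelow-mono t₂ tv₂ w≤w+2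

    u<w+2 : ∀ {u} → u ≤ w → u < w + 2
    u<w+2 u≤w = ≤-<-trans u≤w (m<m+n w (s≤s z≤n))

    second : ∀ {s′ u l₁ l₂} → Agree w s s′ → u ≤ w → s′ u ≡ l₁ →
             Den s′ h t₂ l₂ × Witness s′ h (w + 2) (ψ u) l₂ → Den s h t₂ l₂ × Witness₂ s h w ψ l₁ l₂
    second ag u≤w su≡l₁ (d₂ , s″ , v , ag′ , v≤ , sv≡l₂ , q) =
      Den-agree t₂ tv₂ (Agree-sym ag) d₂ ,
      s″ , _ , v , Agree-trans w≤w+2 ag ag′ , u≤w , v≤ , trans (sym (ag′ (u<w+2 u≤w))) su≡l₁ , sv≡l₂ , q

  let2ₛ-sound : (∀ u v → StarFree (ψ u v)) → s , h ⊨ let2ₛ t₁ t₂ w ψ →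
                Denote₂ s h t₁ t₂ (Witness₂ s h w ψ)
  let2ₛ-sound sf-ψ p
    with letₛ-sound s h w (λ u → letₛ t₂ (w + 2) (ψ u)) t₁ (λ u → sf-let t₂ (w + 2) (ψ u) (sf-ψ u)) tv₁ p
  ... | l₁ , d₁ , s′ , u , ag , u≤w , su≡l₁ , p′
    with letₛ-sound s′ h (w + 2) (ψ u) t₂ (sf-ψ u) tv₂′ p′
  ... | l₂ , rest = let (d₂ , wit) = second ag u≤w su≡l₁ rest in l₁ , l₂ , d₁ , d₂ , wit

  let2ₛ-sound¬¬ : s , h ⊨ let2ₛ t₁ t₂ w ψ → ¬ ¬ Denote₂ s h t₁ t₂ (Witness₂ s h w ψ)
  let2ₛ-sound¬¬ p k =
    letₛ-sound¬¬ s h w (λ u → letₛ t₂ (w + 2) (ψ u)) t₁ tv₁ p λ (l₁ , d₁ , s′ , u , ag , u≤w , su≡l₁ , p′) →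
    letₛ-sound¬¬ s′ h (w + 2) (ψ u) t₂ tv₂′ p′ λ (l₂ , rest) →
      let (d₂ , wit) = second ag u≤w su≡l₁ rest in k (l₁ , l₂ , d₁ , d₂ , wit)

  let2ₛ-complete : ∀ {l₁ l₂} → Den s h t₁ l₁ → Den s h t₂ l₂ → Everywhere₂ s h w ψ l₁ l₂ →
                   s , h ⊨ let2ₛ t₁ t₂ w ψ
  let2ₛ-complete d₁ d₂ holds =
    letₛ-complete s h w (λ u → letₛ t₂ (w + 2) (ψ u)) t₁ tv₁ d₁ λ s′ u ag u≤w su≡l₁ →
    letₛ-complete s′ h (w + 2) (ψ u) t₂ tv₂′ (Den-agree t₂ tv₂ ag d₂) λ s″ v ag′ v≤ sv≡l₂ →
      holds s″ u v (Agree-trans w≤w+2 ag ag′) u≤w v≤ (trans (sym (ag′ (u<w+2 u≤w))) su≡l₁) sv≡l₂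

-- Equality and sees

FarHit : Heap → LOC → LOC → ℕ → Set
FarHit h a b k = ∃ λ δ → suc k ≤ δ × FirstHit h a b δ

farₛ : PVAR → PVAR → ℕ → PVAR → Form
farₛ u v zero    p = reachₛ u v
farₛ u v (suc k) p = ∃⇝ p u v ((u ↪ p) ∧ₛ ((¬ₛ (p ≐ v)) ∧ₛ farₛ p v k (suc p)))

sf-far : ∀ u v k p → StarFree (farₛ u v k p)
sf-far u v zero    p = sf-reach u v
sf-far u v (suc k) p = sf-∃⇝ p u v (sf-∧ (sf-↪ u p) (sf-∧ (sf-¬ (sf-≐ p v)) (sf-far p v k (suc p))))

farₛ-sound : ∀ s h u v k p → u < p → v < p → s , h ⊨ farₛ u v k p → FarHit h (s u) (s v) k
farₛ-sound s h u v zero p _ _ r = let (d , first) = Reach⇒FirstHit (reachₛ-sound s h u v r) in d , proj₁ first , first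
farₛ-sound s h u v (suc k) p u<p v<p (_ , l , _ , hu , p≢v , far)
  with farₛ-sound (update s p l) h p v k (suc p) (n<1+n p) (m<n⇒m<1+n v<p) far
... | δ , k<δ , first = suc δ , s≤s k<δ ,
  FirstHit-suc⁺ (subst₂ (λ x y → fn h x ≡ just y) at-u at-p hu)
                (λ l≡v → p≢v (trans at-p (trans l≡v (sym at-v))))
                (subst₂ (λ x y → FirstHit h x y δ) at-p at-v first)
  where
  at-p = update-≡ s p l
  at-u = update-≢ s p l (<⇒≢ u<p)
  at-v = update-≢ s p l (<⇒≢ v<p)

farₛ-complete : ∀ s h u v k p → u < p → v < p → FarHit h (s u) (s v) k → s , h ⊨ farₛ u v k p
farₛ-complete s h u v zero p _ _ (_ , _ , first) = reachₛ-complete s h u v (FirstHit⇒Reach first)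
farₛ-complete s h u v (suc k) p u<p v<p (suc δ , s≤s k<δ , first@(_ , eδ , _))
  with iter-suc⁻ h δ eδ
... | l , hu , _ =
  (s u , Reach⇒source∈minpath (FirstHit⇒Reach first)) , l ,
  inj₁ (beforeFirstHit⇒minpath first (s≤s 1≤δ) hu) ,
  subst₂ (λ x y → fn h x ≡ just y) (sym at-u) (sym at-p) hu ,
  (λ p≡v → l≢v (trans (sym at-p) (trans p≡v at-v))) ,
  farₛ-complete (update s p l) h p v k (suc p) (n<1+n p) (m<n⇒m<1+n v<p)
    (δ , k<δ , subst₂ (λ x y → FirstHit h x y δ) (sym at-p) (sym at-v) first′)
  where
  1≤δ = ≤-trans (s≤s z≤n) k<δ
  at-p = update-≡ s p l
  at-u = update-≢ s p l (<⇒≢ u<p)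
  at-v = update-≢ s p l (<⇒≢ v<p)
  l≢v = proj₁ (FirstHit-suc⁻ hu first 1≤δ)
  first′ = proj₂ (FirstHit-suc⁻ hu first 1≤δ)

noneDenoteₛ : List Term → PVAR → Form
noneDenoteₛ []      q = ⊤ₛ
noneDenoteₛ (t ∷ T) q = (¬ₛ (denotesₛ t q)) ∧ₛ noneDenoteₛ T q

sf-noneDenote : ∀ T q → StarFree (noneDenoteₛ T q)
sf-noneDenote []      q = sf-⊤
sf-noneDenote (t ∷ T) q = sf-∧ (sf-¬ (sf-denotes t q)) (sf-noneDenote T q)

NoneDenote : Store → Heap → List Term → LOC → Set
NoneDenote s h T l = ∀ t → t ∈ T → ¬ Den s h t l

noneDenoteₛ-sound : ∀ s h T q → All (λ t → VarsBelow t q) T → s , h ⊨ noneDenoteₛ T q → NoneDenote s h T (s q)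
noneDenoteₛ-sound s h (t ∷ T) q (tv ∷ _)  (¬d , _)    t (here refl) d = ¬d (denotesₛ-complete s h t q tv d)
noneDenoteₛ-sound s h (_ ∷ T) q (_ ∷ tvs) (_ , rest) t (there t∈T) = noneDenoteₛ-sound s h T q tvs rest t t∈T

noneDenoteₛ-complete : ∀ s h T q → All (λ t → VarsBelow t q) T → NoneDenote s h T (s q) → s , h ⊨ noneDenoteₛ T q
noneDenoteₛ-complete s h []      q []         _    = ⊤ₛ-intro s h
noneDenoteₛ-complete s h (t ∷ T) q (tv ∷ tvs) none =
  (λ d → none t (here refl) (denotesₛ-sound s h t q tv d)) ,
  noneDenoteₛ-complete s h T q tvs (λ t′ t′∈T → none t′ (there t′∈T))

NoneDenote-agree : ∀ {w s s′ h T l} → All (λ t → VarsBelow t w) T → Agree w s s′ →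
                   NoneDenote s h T l → NoneDenote s′ h T l
NoneDenote-agree tvs ag none t t∈T d = none t t∈T (Den-agree t (All.lookup tvs t∈T) (Agree-sym ag) d)

Avoiding : Store → Heap → List Term → LOC → LOC → Set
Avoiding s h T a b = ∀ δ → FirstHit h a b δ →
  ∀ δ′ → 1 ≤ δ′ → δ′ ≤ δ ∸ 1 → ∀ l → iter h δ′ a ≡ just l → NoneDenote s h T l

-- Excluding u is harmless: a path up to its first hit never returns to its start
-- (FirstHit-no-return).
avoidₛ : List Term → PVAR → PVAR → PVAR → Form
avoidₛ T u v q = ¬ₛ (∃⇝ q u v ((¬ₛ (q ≐ u)) ∧ₛ ((¬ₛ (q ≐ v)) ∧ₛ (¬ₛ (noneDenoteₛ T q)))))

sf-avoid : ∀ T u v q → StarFree (avoidₛ T u v q)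
sf-avoid T u v q = sf-¬ (sf-∃⇝ q u v (sf-∧ (sf-¬ (sf-≐ q u)) (sf-∧ (sf-¬ (sf-≐ q v)) (sf-¬ (sf-noneDenote T q)))))

module _ (s : Store) (h : Heap) (T : List Term) (u v q : PVAR) (u<q : u < q) (v<q : v < q)
         (tvs : All (λ t → VarsBelow t q) T) where

  private
    s[_] : LOC → Store
    s[ l ] = update s q l

    at-q : ∀ l → s[ l ] q ≡ l
    at-q l = update-≡ s q l

    at-u : ∀ l → s[ l ] u ≡ s u
    at-u l = update-≢ s q l (<⇒≢ u<q)

    at-v : ∀ l → s[ l ] v ≡ s v
    at-v l = update-≢ s q l (<⇒≢ v<q)

    ag : ∀ l → Agree q s s[ l ]
    ag l = Agree-update s l ≤-refl

  avoidₛ-sound : s , h ⊨ avoidₛ T u v q → Avoiding s h T (s u) (s v)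
  avoidₛ-sound avoid δ first@(1≤δ , _ , before) δ′ 1≤δ′ le l e t t∈T d = avoid
    ((s u , Reach⇒source∈minpath (FirstHit⇒Reach first)) , l , inj₁ (beforeFirstHit⇒minpath first (≤∸1⇒< 1≤δ le) e) ,
     (λ l≡u → FirstHit-no-return first 1≤δ′ le (trans e (cong just (trans (sym (at-q l)) (trans l≡u (at-u l)))))) ,
     (λ l≡v → before δ′ 1≤δ′ le (trans e (cong just (trans (sym (at-q l)) (trans l≡v (at-v l)))))) ,
     λ none → noneDenoteₛ-sound s[ l ] h T q tvs none t t∈T
                (subst (Den s[ l ] h t) (sym (at-q l)) (Den-agree t (All.lookup tvs t∈T) (ag l) d)))

  avoidₛ-complete : Avoiding s h T (s u) (s v) → s , h ⊨ avoidₛ T u v q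
  avoidₛ-complete avoiding (_ , l , inj₂ l≡v , _ , l≢v , _) = l≢v (trans (at-q l) (trans l≡v (sym (at-v l))))
  avoidₛ-complete avoiding (_ , l , inj₁ mp , l≢u , _ , ¬none) with minpath⇒beforeFirstHit mp
  ... | d , first , zero , _ , e = l≢u (trans (at-q l) (trans (sym (just-injective e)) (sym (at-u l))))
  ... | d , first , suc k , k<d , e = ¬none (noneDenoteₛ-complete s[ l ] h T q tvs
        (subst (NoneDenote s[ l ] h T) (sym (at-q l))
          (NoneDenote-agree tvs (ag l) (avoiding d first (suc k) (s≤s z≤n) (<⇒≤∸1 k<d) l e))))

Avoiding-agree : ∀ {w s s′ h T a b} → All (λ t → VarsBelow t w) T → Agree w s s′ →
                 Avoiding s h T a b → Avoiding s′ h T a b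
Avoiding-agree tvs ag avoiding δ first δ′ 1≤δ′ le l e = NoneDenote-agree tvs ag (avoiding δ first δ′ 1≤δ′ le l e)

eqₛ : Term → Term → Form
eqₛ t₁ t₂ = let2ₛ t₁ t₂ (varBound t₁ ⊔ varBound t₂) _≐_

eqₛ-correct : ∀ t₁ t₂ s h → (s , h ⊨ eqₛ t₁ t₂) ⇔ (s , h ⊨ᶜ eqC t₁ t₂)
eqₛ-correct t₁ t₂ s h = mk⇔ sound complete
  where
  w = varBound t₁ ⊔ varBound t₂
  tv₁ = VarsBelow-mono t₁ (VarsBelow-varBound t₁) (m≤m⊔n (varBound t₁) (varBound t₂))
  tv₂ = VarsBelow-mono t₂ (VarsBelow-varBound t₂) (m≤n⊔m (varBound t₁) (varBound t₂))
  sound : s , h ⊨ eqₛ t₁ t₂ → s , h ⊨ᶜ eqC t₁ t₂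
  sound p with let2ₛ-sound s h w _≐_ t₁ t₂ tv₁ tv₂ (λ u v → sf-≐ u v) p
  ... | l₁ , l₂ , d₁ , d₂ , _ , _ , _ , _ , _ , _ , su≡l₁ , sv≡l₂ , su≡sv =
    l₁ , d₁ , subst (Den s h t₂) (trans (sym sv≡l₂) (trans (sym su≡sv) su≡l₁)) d₂
  complete : s , h ⊨ᶜ eqC t₁ t₂ → s , h ⊨ eqₛ t₁ t₂
  complete (l , d₁ , d₂) =
    let2ₛ-complete s h w _≐_ t₁ t₂ tv₁ tv₂ d₁ d₂ λ _ _ _ _ _ _ su≡l sv≡l → trans su≡l (sym sv≡l)

u<w+4 : ∀ {u w} → u ≤ w → u < w + 4
u<w+4 {w = w} u≤w = ≤-<-trans u≤w (m<m+n w (s≤s z≤n))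

v<w+4 : ∀ {v w} → v ≤ w + 2 → v < w + 4
v<w+4 {w = w} v≤ = ≤-<-trans v≤ (+-monoʳ-< w (s≤s (s≤s (s≤s z≤n))))

SeesFrom : Store → Heap → List Term → ℕ → LOC → LOC → Set
SeesFrom s h T β l₁ l₂ = FarHit h l₁ l₂ β × Avoiding s h T l₁ l₂

Sees⇒SeesFrom : ∀ {s h T t₁ t₂ β} → Sees s h T t₁ t₂ (suc β) → Denote₂ s h t₁ t₂ (SeesFrom s h T β)
Sees⇒SeesFrom (l₁ , l₂ , d₁ , d₂ , δ , β<δ , e , before) =
  l₁ , l₂ , d₁ , d₂ , (δ , β<δ , first) ,
  λ δ′ first′ δ″ 1≤δ″ le l e′ →
    proj₂ (before δ″ 1≤δ″ (subst (λ d → δ″ ≤ d ∸ 1) (FirstHit-unique first′ first) le) l e′)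
  where
  first = ≤-trans (s≤s z≤n) β<δ , e , λ δ′ 1≤δ′ le e′ → proj₁ (before δ′ 1≤δ′ le _ e′) refl

SeesFrom⇒Sees : ∀ {s h T t₁ t₂ β} → Denote₂ s h t₁ t₂ (SeesFrom s h T β) → Sees s h T t₁ t₂ (suc β)
SeesFrom⇒Sees {h = h} (l₁ , l₂ , d₁ , d₂ , (δ , β<δ , first@(_ , e , before)) , avoiding) =
  l₁ , l₂ , d₁ , d₂ , δ , β<δ , e ,
  λ δ′ 1≤δ′ le l e′ → (λ l≡l₂ → before δ′ 1≤δ′ le (subst (λ x → iter h δ′ l₁ ≡ just x) l≡l₂ e′)) ,
                      avoiding δ first δ′ 1≤δ′ le l e′

seesₛ : List Term → Term → Term → ℕ → Form
seesₛ T t₁ t₂ β = let2ₛ t₁ t₂ w (λ u v → farₛ u v β (w + 4) ∧ₛ avoidₛ T u v (w + 4))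
  where w = varBound t₁ ⊔ varBound t₂ ⊔ varsBound T

seesₛ-correct : ∀ T t₁ t₂ β s h → (s , h ⊨ seesₛ T t₁ t₂ β) ⇔ (s , h ⊨ᶜ seesC T t₁ t₂ β)
seesₛ-correct T t₁ t₂ β s h = mk⇔ (SeesFrom⇒Sees ∘ sound) (complete ∘ Sees⇒SeesFrom)
  where
  w = varBound t₁ ⊔ varBound t₂ ⊔ varsBound T
  ψ = λ u v → farₛ u v β (w + 4) ∧ₛ avoidₛ T u v (w + 4)
  w₁₂≤w = m≤m⊔n (varBound t₁ ⊔ varBound t₂) (varsBound T)
  tv₁ = VarsBelow-mono t₁ (VarsBelow-varBound t₁) (≤-trans (m≤m⊔n (varBound t₁) (varBound t₂)) w₁₂≤w)
  tv₂ = VarsBelow-mono t₂ (VarsBelow-varBound t₂) (≤-trans (m≤n⊔m (varBound t₁) (varBound t₂)) w₁₂≤w)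
  tvs : All (λ t → VarsBelow t w) T
  tvs = All-VarsBelow-mono (m≤n⊔m (varBound t₁ ⊔ varBound t₂) (varsBound T)) (VarsBelow-varsBound T)
  tvs′ = All-VarsBelow-mono (m≤m+n w 4) tvs
  sound : s , h ⊨ seesₛ T t₁ t₂ β → Denote₂ s h t₁ t₂ (SeesFrom s h T β)
  sound p with let2ₛ-sound s h w ψ t₁ t₂ tv₁ tv₂ (λ u v → sf-∧ (sf-far u v β (w + 4)) (sf-avoid T u v (w + 4))) p
  ... | l₁ , l₂ , d₁ , d₂ , s′ , u , v , ag , u≤w , v≤ , refl , refl , far , avoid =
    l₁ , l₂ , d₁ , d₂ , farₛ-sound s′ h u v β (w + 4) (u<w+4 u≤w) (v<w+4 v≤) far ,
    Avoiding-agree tvs (Agree-sym ag) (avoidₛ-sound s′ h T u v (w + 4) (u<w+4 u≤w) (v<w+4 v≤) tvs′ avoid)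
  complete : Denote₂ s h t₁ t₂ (SeesFrom s h T β) → s , h ⊨ seesₛ T t₁ t₂ β
  complete (l₁ , l₂ , d₁ , d₂ , far , avoiding) =
    let2ₛ-complete s h w ψ t₁ t₂ tv₁ tv₂ d₁ d₂ λ where
      s′ u v ag u≤w v≤ refl refl →
        farₛ-complete s′ h u v β (w + 4) (u<w+4 u≤w) (v<w+4 v≤) far ,
        avoidₛ-complete s′ h T u v (w + 4) (u<w+4 u≤w) (v<w+4 v≤) tvs′ (Avoiding-agree tvs ag avoiding)

InDom? : ∀ h → Decidable (InDom h)
InDom? h l with fn h l
... | just z  = yes (z , refl)
... | nothing = no λ ()

-- A record, so that the three heaps can be inferred from a splitting.
record Splitting (h h₁ h₂ : Heap) : Set where
  constructor splitting
  field split : Split h h₁ h₂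

Splitting-comm : ∀ {h h₁ h₂} → Splitting h h₁ h₂ → Splitting h h₂ h₁
Splitting-comm (splitting split) = splitting λ l → swap (split l)

Splitting-fnˡ : ∀ {h h₁ h₂ x y} → Splitting h h₁ h₂ → fn h₁ x ≡ just y → fn h x ≡ just y
Splitting-fnˡ {x = x} (splitting split) e with split x
... | inj₁ (free₁ , _) = contradiction (trans (sym e) free₁) λ ()
... | inj₂ (_ , same)  = trans same e

Splitting-domˡ : ∀ {h h₁ h₂ l} → Splitting h h₁ h₂ → InDom h₁ l → InDom h l
Splitting-domˡ split (z , e) = z , Splitting-fnˡ split e

Splitting-domʳ : ∀ {h h₁ h₂ l} → Splitting h h₁ h₂ → InDom h₂ l → InDom h l
Splitting-domʳ split = Splitting-domˡ (Splitting-comm split)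

Splitting-iterˡ : ∀ {h h₁ h₂} k {x y} → Splitting h h₁ h₂ → iter h₁ k x ≡ just y → iter h k x ≡ just y
Splitting-iterˡ zero    split e = e
Splitting-iterˡ {h} {h₁} (suc k) {x} split e with >>=-just⁻ (iter h₁ k x) (fn h₁) e
... | z , e₁ , fz = trans (cong (_>>= fn h) (Splitting-iterˡ k split e₁)) (Splitting-fnˡ split fz)

Splitting-disjoint : ∀ {h h₁ h₂ l} → Splitting h h₁ h₂ → InDom h₁ l → ¬ InDom h₂ l
Splitting-disjoint {l = l} (splitting split) (_ , e₁) (_ , e₂) with split l
... | inj₁ (free₁ , _) = contradiction (trans (sym e₁) free₁) λ ()
... | inj₂ (free₂ , _) = contradiction (trans (sym e₂) free₂) λ ()

minpath⊆domˡ : ∀ {h h₁ h₂ a b l} → Splitting h h₁ h₂ → Reach h₁ a b → InMinpath h a b l → InDom h₁ l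
minpath⊆domˡ {h} {h₁} split (δ , 1≤δ , e) mp with minpath⇒beforeFirstHit mp
... | d , first , k , k<d , eₖ with iter-before-defined h₁ k<δ e
  where k<δ = <-≤-trans k<d (FirstHit-≤ first 1≤δ (Splitting-iterˡ δ split e))
... | p , eₚ , inDom = subst (InDom h₁) (≡just-unique (Splitting-iterˡ k split eₚ) eₖ) inDom

Splitting-fn-outsideʳ : ∀ {h h₁ h₂ l} → Splitting h h₁ h₂ → InDom h l → ¬ InDom h₂ l → fn h l ≡ fn h₁ l
Splitting-fn-outsideʳ {l = l} (splitting split) inDom ∉dom₂ with split l
... | inj₂ (_ , same)    = same
... | inj₁ (_ , same₂) = contradiction (subst (λ x → ∃ λ z → x ≡ just z) same₂ inDom) ∉dom₂

Reach-restrictˡ : ∀ {h h₁ h₂ a b} → Splitting h h₁ h₂ → Reach h a b →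
                  (∀ l → InMinpath h a b l → ¬ InDom h₂ l) → Reach h₁ a b
Reach-restrictˡ {h} {h₁} {a = a} {b} split r avoids with Reach⇒FirstHit r
... | d , first@(1≤d , e , _) = d , 1≤d , trans (sym (same-iter d ≤-refl)) e
  where
  same-iter : ∀ k → k ≤ d → iter h k a ≡ iter h₁ k a
  same-iter zero    _   = refl
  same-iter (suc k) k<d with iter-before-defined h k<d e
  ... | p , eₚ , inDom = begin
    (iter h k a >>= fn h)   ≡⟨ cong (_>>= fn h) eₚ ⟩
    fn h p                  ≡⟨ Splitting-fn-outsideʳ split inDom (avoids p (beforeFirstHit⇒minpath first k<d eₚ)) ⟩
    fn h₁ p                 ≡⟨ cong (_>>= fn h₁) (trans (sym (same-iter k (<⇒≤ k<d))) eₚ) ⟨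
    (iter h₁ k a >>= fn h₁) ∎
    where open ≡-Reasoning

keepIf : Bool → Maybe LOC → Maybe LOC
keepIf b x = if b then x else nothing

keepIf-nothing : ∀ b {x} → x ≡ nothing → keepIf b x ≡ nothing
keepIf-nothing true  e = e
keepIf-nothing false _ = refl

restrict : Heap → {P : Pred LOC 0ℓ} → Decidable P → Heap
restrict h P? = record
  { fn     = λ l → keepIf (does (P? l)) (fn h l)
  ; finite = bound h , λ l le → keepIf-nothing (does (P? l)) (proj₂ (finite h) l le)
  }

module _ (h : Heap) {P : Pred LOC 0ℓ} (P? : Decidable P) where

  restrict-splitting : Splitting h (restrict h P?) (restrict h (¬? ∘ P?))
  restrict-splitting = splitting split
    where
    split : Split h (restrict h P?) (restrict h (¬? ∘ P?))
    split l with does (P? l)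
    ... | true  = inj₂ (refl , refl)
    ... | false = inj₁ (refl , refl)

  restrict-∈ : ∀ {l} → P l → fn (restrict h P?) l ≡ fn h l
  restrict-∈ {l} p with P? l
  ... | yes _ = refl
  ... | no ¬p = contradiction p ¬p

  restrict-InDom : ∀ {l} → P l → InDom h l → InDom (restrict h P?) l
  restrict-InDom p (z , e) = z , trans (restrict-∈ p) e

  restrict-dom⁻ : ∀ {l} → InDom (restrict h P?) l → P l
  restrict-dom⁻ {l} d with P? l
  ... | yes p = p
  ... | no _  = contradiction (proj₂ d) λ ()

nonempty⇒cell : ∀ h → ¬ (∀ l → fn h l ≡ nothing) → ∃ (InDom h)
nonempty⇒cell h nonempty with anyUpTo? (InDom? h) (bound h)
... | yes (l , _ , d) = l , d
... | no none = contradiction free nonempty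
  where
  free : ∀ l → fn h l ≡ nothing
  free l with fn h l in e
  ... | nothing = refl
  ... | just z  = contradiction (l , dom<bound h e , z , e) none

DistinctCells : Heap → ∀ {n} → Vec LOC n → Set
DistinctCells h V = Injective _≡_ _≡_ (lookup V) × (∀ i → InDom h (lookup V i))

sizeₛ : ℕ → Form
sizeₛ zero    = ⊤ₛ
sizeₛ (suc n) = (¬ₛ emp) *ₛ sizeₛ n

sizeₛ-complete : ∀ n (V : Vec LOC n) s h → DistinctCells h V → s , h ⊨ sizeₛ n
sizeₛ-complete zero    V        s h _ = ⊤ₛ-intro s h
sizeₛ-complete (suc n) (l ∷ V) s h (injective , cells) =
  restrict h (_≟ l) , restrict h (¬? ∘ (_≟ l)) , Splitting.split (restrict-splitting h (_≟ l)) ,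
  first-cell , sizeₛ-complete n V s _ (Fin-suc-injective ∘ injective , cells′)
  where
  first-cell : ¬ (∀ x → fn (restrict h (_≟ l)) x ≡ nothing)
  first-cell empty with cells zero
  ... | _ , eₗ = contradiction (trans (sym eₗ) (trans (sym (restrict-∈ h (_≟ l) refl)) (empty l))) λ ()
  cells′ : ∀ i → InDom (restrict h (¬? ∘ (_≟ l))) (lookup V i)
  cells′ i = restrict-InDom h (¬? ∘ (_≟ l)) (λ eq → contradiction (injective {suc i} {zero} eq) λ ()) (cells (suc i))

sizeₛ-sound : ∀ n s h → s , h ⊨ sizeₛ n → Σ (Vec LOC n) (DistinctCells h)
sizeₛ-sound zero    s h _ = [] , (λ { {()} }) , λ ()
sizeₛ-sound (suc n) s h (h₁ , h₂ , split′ , nonempty , rest)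
  with nonempty⇒cell h₁ nonempty | sizeₛ-sound n s h₂ rest
... | l , l∈h₁ | V , injective , cells =
  l ∷ V , injective′ , λ { zero → Splitting-domˡ split l∈h₁ ; (suc i) → Splitting-domʳ split (cells i) }
  where
  split : Splitting h h₁ h₂
  split = splitting split′
  injective′ : Injective _≡_ _≡_ (lookup (l ∷ V))
  injective′ {zero}  {zero}  _ = refl
  injective′ {zero}  {suc j} e = contradiction (subst (InDom h₂) (sym e) (cells j)) (Splitting-disjoint split l∈h₁)
  injective′ {suc i} {zero}  e = contradiction (subst (InDom h₂) e (cells i)) (Splitting-disjoint split l∈h₁)
  injective′ {suc i} {suc j} e = cong suc (injective e)

Unique-lookup-injective : ∀ {xs : List ℕ} → Unique xs → Injective _≡_ _≡_ (List.lookup xs)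
Unique-lookup-injective {_ ∷ _} (_ ∷ _)  {zero}  {zero}  _ = refl
Unique-lookup-injective {_ ∷ _} (x≢ ∷ _) {zero}  {suc j} e = contradiction e (All.lookup x≢ (∈-lookup j))
Unique-lookup-injective {_ ∷ _} (x≢ ∷ _) {suc i} {zero}  e = contradiction (sym e) (All.lookup x≢ (∈-lookup i))
Unique-lookup-injective {_ ∷ _} (_ ∷ u)  {suc i} {suc j} e = cong suc (Unique-lookup-injective u e)

DistinctVec : ∀ (Q : Pred ℕ 0ℓ) n → Set
DistinctVec Q n = Σ (Vec ℕ n) λ V → Injective _≡_ _≡_ (lookup V) × (∀ i → Q (lookup V i))

-- At least n distinct elements satisfy Q iff the list of all of them, below N, has length ≥ n.
module _ {Q : Pred ℕ 0ℓ} (Q? : Decidable Q) {N} (Q⇒<N : ∀ {l} → Q l → l < N) where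

  private
    candidates : List ℕ
    candidates = List.filter Q? (List.upTo N)

    candidates-unique : Unique candidates
    candidates-unique = Uniqueₚ.filter⁺ Q? (Uniqueₚ.upTo⁺ N)

    candidate-Q : ∀ i → Q (List.lookup candidates i)
    candidate-Q i = proj₂ (∈-filter⁻ Q? {xs = List.upTo N} (∈-lookup i))

    candidate-index : ∀ {l} → Q l → Fin (List.length candidates)
    candidate-index q = Any.index (∈-filter⁺ Q? (∈-upTo⁺ (Q⇒<N q)) q)

    lookup-candidate-index : ∀ {l} (q : Q l) → l ≡ List.lookup candidates (candidate-index q)
    lookup-candidate-index q = Anyₚ.lookup-index (∈-filter⁺ Q? (∈-upTo⁺ (Q⇒<N q)) q)

    candidate-index-injective : ∀ {n} {V : Vec ℕ n} → Injective _≡_ _≡_ (lookup V) →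
      (qs : ∀ i → Q (lookup V i)) → Injective _≡_ _≡_ (λ i → candidate-index (qs i))
    candidate-index-injective injective qs {i} {j} e = injective (begin
      _                                                 ≡⟨ lookup-candidate-index (qs i) ⟩
      List.lookup candidates (candidate-index (qs i))   ≡⟨ cong (List.lookup candidates) e ⟩
      List.lookup candidates (candidate-index (qs j))   ≡⟨ lookup-candidate-index (qs j) ⟨
      _                                                 ∎)
      where open ≡-Reasoning

  distinct? : ∀ n → Dec (DistinctVec Q n)
  distinct? n with n ≤? List.length candidates
  ... | no n≰k = no λ (V , injective , qs) → n≰k (injective⇒≤ (candidate-index-injective {V = V} injective qs))
  ... | yes n≤k = yes (Vec.tabulate pick , injective , λ i → subst Q (sym (lookup∘tabulate pick i)) (candidate-Q _))
    where
    pick : Fin n → ℕ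
    pick i = List.lookup candidates (inject≤ i n≤k)
    injective : Injective _≡_ _≡_ (lookup (Vec.tabulate pick))
    injective {i} {j} e = inject≤-injective n≤k n≤k i j (Unique-lookup-injective candidates-unique
      (trans (sym (lookup∘tabulate pick i)) (trans e (lookup∘tabulate pick j))))

∃Den? : ∀ s h t → Dec (∃ (Den s h t))
∃Den? s h t with ⊨? (sf-let t (varBound t) (λ _ → ⊤ₛ) (λ _ → sf-⊤)) s h
... | yes p = let (l , d , _) = letₛ-sound s h (varBound t) (λ _ → ⊤ₛ) t (λ _ → sf-⊤) (VarsBelow-varBound t) p in yes (l , d)
... | no ¬p = no λ (l , d) →
  ¬p (letₛ-complete s h (varBound t) (λ _ → ⊤ₛ) t (VarsBelow-varBound t) d λ s′ _ _ _ _ → ⊤ₛ-intro s′ h)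

InMinpath? : ∀ h a b l → Dec (InMinpath h a b l)
InMinpath? h a b l with Reach? h a b
... | no ¬r = no (¬r ∘ minpath⇒Reach)
... | yes r with Reach⇒FirstHit r
... | d , first with anyUpTo? (λ k → iter≟ h k a l) d
... | yes (k , k<d , e) = yes (beforeFirstHit⇒minpath first k<d e)
... | no none = no λ mp → let (d′ , first′ , k , k<d′ , e) = minpath⇒beforeFirstHit mp
                          in none (k , subst (k <_) (FirstHit-unique first′ first) k<d′ , e)

Denote₂? : ∀ s h t₁ t₂ {Q : LOC → LOC → Set} → (∀ l₁ l₂ → Dec (Q l₁ l₂)) → Dec (Denote₂ s h t₁ t₂ Q)
Denote₂? s h t₁ t₂ {Q} Q? with ∃Den? s h t₁ | ∃Den? s h t₂
... | no ¬d₁ | _ = no λ (l₁ , _ , d₁ , _) → ¬d₁ (l₁ , d₁)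
... | yes _ | no ¬d₂ = no λ (_ , l₂ , _ , d₂ , _) → ¬d₂ (l₂ , d₂)
... | yes (l₁ , d₁) | yes (l₂ , d₂) with Q? l₁ l₂
... | yes q = yes (l₁ , l₂ , d₁ , d₂ , q)
... | no ¬q = no λ (l₁′ , l₂′ , d₁′ , d₂′ , q) → ¬q (subst₂ Q (Den-unique t₁ d₁′ d₁) (Den-unique t₂ d₂′ d₂) q)

Covered? : ∀ s h P l → Dec (Covered s h P l)
Covered? s h [] l = no λ { (_ , _ , () , _) }
Covered? s h ((t₁ , t₂) ∷ P) l with Denote₂? s h t₁ t₂ (λ l₁ l₂ → InMinpath? h l₁ l₂ l) | Covered? s h P l
... | yes here′ | _ = yes (t₁ , t₂ , here refl , here′)
... | no _ | yes (t₁′ , t₂′ , i , there′) = yes (t₁′ , t₂′ , there i , there′)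
... | no ¬here | no ¬there = no λ where
  (_ , _ , here refl , here′) → ¬here here′
  (t₁′ , t₂′ , there i , there′) → ¬there (t₁′ , t₂′ , i , there′)

-- The rem formula

linkedₛ : Term → Term → PVAR → Form
linkedₛ t₁ t₂ w = let2ₛ t₁ t₂ w reachₛ

module _ (s : Store) (h : Heap) (t₁ t₂ : Term) (w : PVAR) (tv₁ : VarsBelow t₁ w) (tv₂ : VarsBelow t₂ w) where

  linkedₛ-sound : s , h ⊨ linkedₛ t₁ t₂ w → Denote₂ s h t₁ t₂ (Reach h)
  linkedₛ-sound p with let2ₛ-sound s h w reachₛ t₁ t₂ tv₁ tv₂ sf-reach p
  ... | l₁ , l₂ , d₁ , d₂ , s′ , u , v , _ , _ , _ , refl , refl , r = l₁ , l₂ , d₁ , d₂ , reachₛ-sound s′ h u v r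

  linkedₛ-complete : Denote₂ s h t₁ t₂ (Reach h) → s , h ⊨ linkedₛ t₁ t₂ w
  linkedₛ-complete (_ , _ , d₁ , d₂ , r) =
    let2ₛ-complete s h w reachₛ t₁ t₂ tv₁ tv₂ d₁ d₂ λ { s′ u v _ _ _ refl refl → reachₛ-complete s′ h u v r }

-- A record for the same reason as Splitting.
record Uncovered (s : Store) (h : Heap) (P : List (Term × Term)) (h₂ : Heap) : Set where
  constructor uncovered
  field ¬covered : ∀ l → InDom h₂ l → ¬ Covered s h P l

Uncovered-tail : ∀ {s h t₁ t₂ P h₂} → Uncovered s h ((t₁ , t₂) ∷ P) h₂ → Uncovered s h P h₂
Uncovered-tail (uncovered nc) = uncovered λ l l∈h₂ (t₁ , t₂ , i , c) → nc l l∈h₂ (t₁ , t₂ , there i , c)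

Uncovered-∷-unlinked : ∀ {s h t₁ t₂ P h₂} → ¬ Denote₂ s h t₁ t₂ (Reach h) →
                       Uncovered s h P h₂ → Uncovered s h ((t₁ , t₂) ∷ P) h₂
Uncovered-∷-unlinked unlinked (uncovered nc) = uncovered λ where
  l l∈h₂ (_ , _ , here refl , l₁ , l₂ , d₁ , d₂ , mp) → unlinked (l₁ , l₂ , d₁ , d₂ , minpath⇒Reach mp)
  l l∈h₂ (t₁′ , t₂′ , there i , c)                   → nc l l∈h₂ (t₁′ , t₂′ , i , c)

Uncovered-∷-linked : ∀ {s h h₁ h₂ t₁ t₂ P} → Splitting h h₁ h₂ → Denote₂ s h t₁ t₂ (Reach h₁) →
                     Uncovered s h P h₂ → Uncovered s h ((t₁ , t₂) ∷ P) h₂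
Uncovered-∷-linked {h = h} {t₁ = t₁} {t₂} split (l₁ , l₂ , d₁ , d₂ , r) (uncovered nc) = uncovered λ where
  l l∈h₂ (_ , _ , here refl , l₁′ , l₂′ , d₁′ , d₂′ , mp) →
    Splitting-disjoint split (minpath⊆domˡ split r
      (subst₂ (λ a b → InMinpath h a b l) (Den-unique t₁ d₁′ d₁) (Den-unique t₂ d₂′ d₂) mp)) l∈h₂
  l l∈h₂ (t₁′ , t₂′ , there i , c) → nc l l∈h₂ (t₁′ , t₂′ , i , c)

Linked-restrict : ∀ {s h h₁ h₂ t₁ t₂ P} → Splitting h h₁ h₂ → Uncovered s h ((t₁ , t₂) ∷ P) h₂ →
                  ∀ {l₁ l₂} → Den s h t₁ l₁ → Den s h t₂ l₂ → Reach h l₁ l₂ → Reach h₁ l₁ l₂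
Linked-restrict split (uncovered nc) d₁ d₂ r =
  Reach-restrictˡ split r λ l mp l∈h₂ → nc l l∈h₂ (_ , _ , here refl , _ , _ , d₁ , d₂ , mp)

Denote₂-agree : ∀ {w s s′ h t₁ t₂ Q} → VarsBelow t₁ w → VarsBelow t₂ w → Agree w s s′ →
                Denote₂ s h t₁ t₂ Q → Denote₂ s′ h t₁ t₂ Q
Denote₂-agree {t₁ = t₁} {t₂} tv₁ tv₂ ag (l₁ , l₂ , d₁ , d₂ , q) =
  l₁ , l₂ , Den-agree t₁ tv₁ ag d₁ , Den-agree t₂ tv₂ ag d₂ , q

PairsBelow : List (PVAR × PVAR) → ℕ → Set
PairsBelow o w = All (λ (u , v) → u < w × v < w) o

PairsBelow-mono : ∀ {o w w′} → w ≤ w′ → PairsBelow o w → PairsBelow o w′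
PairsBelow-mono w≤w′ = All.map λ (u<w , v<w) → <-≤-trans u<w w≤w′ , <-≤-trans v<w w≤w′

ReachAll : Heap → Store → List (PVAR × PVAR) → Set
ReachAll h s o = All (λ (u , v) → Reach h (s u) (s v)) o

ReachAll-agree : ∀ {w s s′ h o} → PairsBelow o w → Agree w s s′ → ReachAll h s o → ReachAll h s′ o
ReachAll-agree {h = h} []                 ag []       = []
ReachAll-agree {h = h} ((u<w , v<w) ∷ ob) ag (r ∷ rs) = subst₂ (Reach h) (ag u<w) (ag v<w) r ∷ ReachAll-agree ob ag rs

reachAllₛ : List (PVAR × PVAR) → Form
reachAllₛ []            = ⊤ₛ
reachAllₛ ((u , v) ∷ o) = reachₛ u v ∧ₛ reachAllₛ o

reachAllₛ-sound : ∀ s h o → s , h ⊨ reachAllₛ o → ReachAll h s o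
reachAllₛ-sound s h []            _        = []
reachAllₛ-sound s h ((u , v) ∷ o) (r , rs) = reachₛ-sound s h u v r ∷ reachAllₛ-sound s h o rs

reachAllₛ-complete : ∀ s h o → ReachAll h s o → s , h ⊨ reachAllₛ o
reachAllₛ-complete s h []            []       = ⊤ₛ-intro s h
reachAllₛ-complete s h ((u , v) ∷ o) (r ∷ rs) = reachₛ-complete s h u v r , reachAllₛ-complete s h o rs

TermPairsBelow : List (Term × Term) → ℕ → Set
TermPairsBelow P w = All (λ (t₁ , t₂) → VarsBelow t₁ w × VarsBelow t₂ w) P

pairsBound : List (Term × Term) → ℕ
pairsBound []              = 0
pairsBound ((t₁ , t₂) ∷ P) = varBound t₁ ⊔ varBound t₂ ⊔ pairsBound P

TermPairsBelow-pairsBound : ∀ P → TermPairsBelow P (pairsBound P)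
TermPairsBelow-pairsBound []              = []
TermPairsBelow-pairsBound ((t₁ , t₂) ∷ P) =
  (VarsBelow-mono t₁ (VarsBelow-varBound t₁) (≤-trans (m≤m⊔n (varBound t₁) (varBound t₂)) w₁₂≤w) ,
   VarsBelow-mono t₂ (VarsBelow-varBound t₂) (≤-trans (m≤n⊔m (varBound t₁) (varBound t₂)) w₁₂≤w)) ∷
  All.map (λ {(t₁′ , t₂′)} (tv₁ , tv₂) → VarsBelow-mono t₁′ tv₁ wₚ≤w , VarsBelow-mono t₂′ tv₂ wₚ≤w)
          (TermPairsBelow-pairsBound P)
  where
  w₁₂≤w = m≤m⊔n (varBound t₁ ⊔ varBound t₂) (pairsBound P)
  wₚ≤w  = m≤n⊔m (varBound t₁ ⊔ varBound t₂) (pairsBound P)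

-- The pairs (u , v) in o hold the ends of the pairs of P found to be linked so far.
remₛ′ : List (Term × Term) → List (PVAR × PVAR) → PVAR → ℕ → Form
unlinkedₛ : Term → Term → List (Term × Term) → List (PVAR × PVAR) → PVAR → ℕ → Form
linkedRestₛ : List (Term × Term) → List (PVAR × PVAR) → PVAR → ℕ → PVAR → PVAR → Form

remₛ′ []              o w β = reachAllₛ o *ₛ sizeₛ β
remₛ′ ((t₁ , t₂) ∷ P) o w β = unlinkedₛ t₁ t₂ P o w β ∨ₛ let2ₛ t₁ t₂ w (linkedRestₛ P o w β)

unlinkedₛ t₁ t₂ P o w β = (¬ₛ (linkedₛ t₁ t₂ w)) ∧ₛ remₛ′ P o w β

linkedRestₛ P o w β u v = reachₛ u v ∧ₛ remₛ′ P ((u , v) ∷ o) (w + 4) β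

Decomposition : Store → Heap → List (Term × Term) → Store → List (PVAR × PVAR) → ℕ → Set
Decomposition s h P s′ o β = Σ Heap λ h₁ → Σ Heap λ h₂ →
  Splitting h h₁ h₂ × ReachAll h₁ s′ o × Σ (Vec LOC β) (DistinctCells h₂) × Uncovered s h P h₂

module _ (s : Store) (h : Heap) (β : ℕ) where

  remₛ′-sound : ∀ P o w s′ {F} → TermPairsBelow P F → F ≤ w → Agree F s s′ → PairsBelow o w →
                s′ , h ⊨ remₛ′ P o w β → ¬ ¬ Decomposition s h P s′ o β
  remₛ′-sound [] o w s′ _ _ _ _ (h₁ , h₂ , split , reaches , size) k =
    k (h₁ , h₂ , splitting split , reachAllₛ-sound s′ h₁ o reaches , sizeₛ-sound β s′ h₂ size ,
       uncovered λ { _ _ (_ , _ , () , _) })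
  remₛ′-sound ((t₁ , t₂) ∷ P) o w s′ ((tv₁ , tv₂) ∷ tvs) F≤w ag ob p k = p (unlinked , linked)
    where
    tv₁w = VarsBelow-mono t₁ tv₁ F≤w
    tv₂w = VarsBelow-mono t₂ tv₂ F≤w
    unlinked : ¬ (s′ , h ⊨ unlinkedₛ t₁ t₂ P o w β)
    unlinked (¬linked , rest) = remₛ′-sound P o w s′ tvs F≤w ag ob rest λ (h₁ , h₂ , split , rs , cells , unc) →
      k (h₁ , h₂ , split , rs , cells ,
         Uncovered-∷-unlinked (¬linked ∘ linkedₛ-complete s′ h t₁ t₂ w tv₁w tv₂w ∘ Denote₂-agree tv₁ tv₂ ag) unc)
    linked : ¬ (s′ , h ⊨ let2ₛ t₁ t₂ w (linkedRestₛ P o w β))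
    linked p′ = let2ₛ-sound¬¬ s′ h w (linkedRestₛ P o w β) t₁ t₂ tv₁w tv₂w p′ λ where
      (l₁ , l₂ , d₁ , d₂ , s″ , u , v , ag′ , u≤w , v≤ , refl , refl , _ , rest) →
        remₛ′-sound P ((u , v) ∷ o) (w + 4) s″ tvs (≤-trans F≤w (m≤m+n w 4)) (Agree-trans F≤w ag ag′)
          ((u<w+4 u≤w , v<w+4 v≤) ∷ PairsBelow-mono (m≤m+n w 4) ob) rest λ where
          (h₁ , h₂ , split , r ∷ rs , cells , unc) →
            k (h₁ , h₂ , split , ReachAll-agree ob (Agree-sym ag′) rs , cells ,
               Uncovered-∷-linked split (Denote₂-agree tv₁ tv₂ (Agree-sym ag) (_ , _ , d₁ , d₂ , r)) unc)

  remₛ′-complete : ∀ P o w s′ {F} → TermPairsBelow P F → F ≤ w → Agree F s s′ → PairsBelow o w →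
                   ∀ {h₁ h₂} → Splitting h h₁ h₂ → ReachAll h₁ s′ o → Σ (Vec LOC β) (DistinctCells h₂) →
                   Uncovered s h P h₂ → s′ , h ⊨ remₛ′ P o w β
  remₛ′-complete [] o w s′ _ _ _ _ {h₁} {h₂} split rs (V , cells) _ =
    h₁ , h₂ , Splitting.split split , reachAllₛ-complete s′ h₁ o rs , sizeₛ-complete β V s′ h₂ cells
  remₛ′-complete ((t₁ , t₂) ∷ P) o w s′ ((tv₁ , tv₂) ∷ tvs) F≤w ag ob split rs cells unc
    with Denote₂? s h t₁ t₂ (Reach? h)
  ... | no ¬linked = ∨ₛ-introˡ s′ h (unlinkedₛ t₁ t₂ P o w β) (let2ₛ t₁ t₂ w (linkedRestₛ P o w β))
    (¬linked ∘ Denote₂-agree tv₁ tv₂ (Agree-sym ag) ∘ linkedₛ-sound s′ h t₁ t₂ w tv₁w tv₂w ,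
     remₛ′-complete P o w s′ tvs F≤w ag ob split rs cells (Uncovered-tail unc))
    where
    tv₁w = VarsBelow-mono t₁ tv₁ F≤w
    tv₂w = VarsBelow-mono t₂ tv₂ F≤w
  ... | yes (l₁ , l₂ , d₁ , d₂ , r) = ∨ₛ-introʳ s′ h (unlinkedₛ t₁ t₂ P o w β) (let2ₛ t₁ t₂ w (linkedRestₛ P o w β))
    (let2ₛ-complete s′ h w (linkedRestₛ P o w β) t₁ t₂ (VarsBelow-mono t₁ tv₁ F≤w) (VarsBelow-mono t₂ tv₂ F≤w)
       (Den-agree t₁ tv₁ ag d₁) (Den-agree t₂ tv₂ ag d₂) λ where
       s″ u v ag′ u≤w v≤ refl refl →
         reachₛ-complete s″ h u v r ,
         remₛ′-complete P ((u , v) ∷ o) (w + 4) s″ tvs (≤-trans F≤w (m≤m+n w 4)) (Agree-trans F≤w ag ag′)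
           ((u<w+4 u≤w , v<w+4 v≤) ∷ PairsBelow-mono (m≤m+n w 4) ob) split
           (Linked-restrict split unc d₁ d₂ r ∷ ReachAll-agree ob ag′ rs) cells (Uncovered-tail unc))

remₛ : List (Term × Term) → ℕ → Form
remₛ P β = remₛ′ P [] (pairsBound P) β

Decomposition⇒Rem : ∀ {s h P s′ o β} → Decomposition s h P s′ o β → Rem s h P β
Decomposition⇒Rem (_ , _ , split , _ , (V , injective , cells) , uncovered nc) =
  V , injective , λ i → Splitting-domʳ split (cells i) , nc _ (cells i)

Rem⇒Decomposition : ∀ {s h P β} → Rem s h P β → Decomposition s h P s [] β
Rem⇒Decomposition {s} {h} {P} (V , injective , cells) =
  restrict h (¬? ∘ (_∈? V)) , restrict h (_∈? V) , Splitting-comm (restrict-splitting h (_∈? V)) , [] ,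
  (V , injective , λ i → restrict-InDom h (_∈? V) (∈-lookupᵥ i V) (proj₁ (cells i))) , uncovered nc
  where
  nc : ∀ l → InDom (restrict h (_∈? V)) l → ¬ Covered s h P l
  nc l l∈h₂ = subst (¬_ ∘ Covered s h P) (sym (Anyᵥₚ.lookup-index l∈V)) (proj₂ (cells (Anyᵥ.index l∈V)))
    where l∈V = restrict-dom⁻ h (_∈? V) l∈h₂

remₛ-correct : ∀ P β s h → (s , h ⊨ remₛ P β) ⇔ (s , h ⊨ᶜ remC P β)
remₛ-correct P β s h = mk⇔ sound complete
  where
  tvs = TermPairsBelow-pairsBound P
  sound : s , h ⊨ remₛ P β → Rem s h P β
  -- Rem is decidable, which removes the double negation introduced by the disjunctions of remₛ′.
  sound p = decidable-stable (distinct? (λ l → InDom? h l ×-dec ¬? (Covered? s h P l)) (InDom⇒<bound h ∘ proj₁) β)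
    (remₛ′-sound s h β P [] (pairsBound P) s tvs ≤-refl (Agree-refl _ s) [] p ∘ (_∘ Decomposition⇒Rem))
  complete : Rem s h P β → s , h ⊨ remₛ P β
  complete rem = let (_ , _ , split , _ , cells , unc) = Rem⇒Decomposition rem in
    remₛ′-complete s h β P [] (pairsBound P) s tvs ≤-refl (Agree-refl _ s) [] split [] cells unc

lemma4p1 : (c : Core) → Σ Form λ φ → (s : Store) → (h : Heap) → (s , h ⊨ φ) ⇔ (s , h ⊨ᶜ c)
lemma4p1 (eqC t₁ t₂)        = eqₛ t₁ t₂ , eqₛ-correct t₁ t₂
lemma4p1 (seesC T t₁ t₂ β)  = seesₛ T t₁ t₂ β , seesₛ-correct T t₁ t₂ β
lemma4p1 (remC P β)         = remₛ P β , remₛ-correct P β
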